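{- Let $w$ be a square-free walk in $D$ of length at least $2$, and write $w=xw'y$ with $x,y\in V(D)$. Then every word in the set $\delta(p_xws_y)$ is extremal square-free over $\Gamma$.
   Context: Let $\Gamma=\{\mathtt{a},\mathtt{b},\mathtt{c}\}$ and let $\mathbb{S}_\Gamma$ be the six permutations of $\Gamma$ in cycle notation: $()$ (identity), $(\mathtt{ab})$, $(\mathtt{ac})$, $(\mathtt{bc})$, $(\mathtt{abc})$ (mapping $\mathtt{a}\mapsto\mathtt{b}\mapsto\mathtt{c}\mapsto\mathtt{a}$), $(\mathtt{acb})$. For each $\pi$ let $\tilde\pi$ be a new symbol, $\widetilde{\mathbb{S}}_\Gamma=\{\tilde\pi\}$. The digraph $D$ has vertex set $V(D)=\mathbb{S}_\Gamma\cup\widetilde{\mathbb{S}}_\Gamma$ and exactly the 24 arcs: $()\to\widetilde{(\mathtt{ab})}$, $()\to(\mathtt{bc})$; $(\mathtt{ab})\to\widetilde{()}$, $(\mathtt{ab})\to(\mathtt{abc})$; $(\mathtt{ac})\to\widetilde{(\mathtt{abc})}$, $(\mathtt{ac})\to(\mathtt{acb})$; $(\mathtt{bc})\to\widetilde{(\mathtt{acb})}$, $(\mathtt{bc})\to()$; $(\mathtt{abc})\to\widetilde{(\mathtt{ac})}$, $(\mathtt{abc})\to(\mathtt{ab})$; $(\mathtt{acb})\to\widetilde{(\mathtt{bc})}$, $(\mathtt{acb})\to(\mathtt{ac})$; $\widetilde{()}\to(\mathtt{ac})$, $\widetilde{()}\to\widetilde{(\mathtt{bc})}$; $\widetilde{(\mathtt{ab})}\to(\mathtt{acb})$,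 $\widetilde{(\mathtt{ab})}\to\widetilde{(\mathtt{abc})}$; $\widetilde{(\mathtt{ac})}\to()$, $\widetilde{(\mathtt{ac})}\to\widetilde{(\mathtt{acb})}$; $\widetilde{(\mathtt{bc})}\to(\mathtt{abc})$, $\widetilde{(\mathtt{bc})}\to\widetilde{()}$; $\widetilde{(\mathtt{abc})}\to(\mathtt{bc})$, $\widetilde{(\mathtt{abc})}\to\widetilde{(\mathtt{ab})}$; $\widetilde{(\mathtt{acb})}\to(\mathtt{ab})$, $\widetilde{(\mathtt{acb})}\to\widetilde{(\mathtt{ac})}$. A walk is treated as the word of its successive vertices; its length is the number of vertices; it is square-free if that word has no factor $yy$ with $y$ nonempty. For each $x\in V(D)$, $p_x$ and $s_x$ are new letters. For a word $N$ over $\Gamma$ and $\pi\in\mathbb{S}_\Gamma$, $N_\pi$ is obtained by applying $\pi$ letterwise, and $N_{\tilde\pi}$ is the reversal of $N_\pi$. Let $P=\mathtt{abacbcabcbacabacbcabcbabcacbcabcbacabacbcabcbacbc}$, $Q=\mathtt{abacbabcacbacabacbcacbacabcbabcabacbcabcb}$, $R=\mathtt{abacabcacbacabcbabcacbacabacbcacbacabcbabcabacbcabcb}$, $S=\mathtt{acabacbabcacbacabcbacbcabacbabcacbacabcbabcacbaca}$. The substitution $\delta$ is given on letters by $\delta(x)=\{Q_x,R_x\}$ for $x\in V(D)$; $\delta(p_x)=\{P_x\}$, $\delta(s_x)=\{S_x\}$ for $x\in\mathbb{S}_\Gamma$; $\delta(p_x)=\{S_x\}$, $\delta(s_x)=\{P_x\}$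 for $x\in\widetilde{\mathbb{S}}_\Gamma$; and on words by $\delta(a_1\cdots a_n)=\{A_1\cdots A_n: A_i\in\delta(a_i)\}$. An extension of a word $u$ over $\Gamma$ is a word $u'au''$ with $a\in\Gamma$, $u'u''=u$; $u$ is extremal square-free if $u$ is square-free and no extension of $u$ is square-free. -}

module Defs where

open import Data.List using (List; []; _∷_; _++_; map; reverse; concatMap; [_])
open import Data.List.Relation.Unary.Linked using (Linked)
open import Data.List.Membership.Propositional using (_∈_)
open import Data.Product using (∃; _×_; _,_)
open import Relation.Binary.PropositionalEquality using (_≡_; _≢_)
open import Relation.Nullary using (¬_)

data Γ : Set where
  `a `b `c : Γ

data Perm : Set where
  id ab ac bc abc acb : Perm

act : Perm → Γ → Γ
act id  x  = x
act ab  `a = `b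
act ab  `b = `a
act ab  `c = `c
act ac  `a = `c
act ac  `b = `b
act ac  `c = `a
act bc  `a = `a
act bc  `b = `c
act bc  `c = `b
act abc `a = `b
act abc `b = `c
act abc `c = `a
act acb `a = `c
act acb `b = `a
act acb `c = `b

data V : Set where
  ⟨_⟩ : Perm → V
  ~_  : Perm → V

data Arc : V → V → Set where
  a1  : Arc ⟨ id ⟩ (~ ab)
  a2  : Arc ⟨ id ⟩ ⟨ bc ⟩
  a3  : Arc ⟨ ab ⟩ (~ id)
  a4  : Arc ⟨ ab ⟩ ⟨ abc ⟩
  a5  : Arc ⟨ ac ⟩ (~ abc)
  a6  : Arc ⟨ ac ⟩ ⟨ acb ⟩
  a7  : Arc ⟨ bc ⟩ (~ acb)
  a8  : Arc ⟨ bc ⟩ ⟨ id ⟩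
  a9  : Arc ⟨ abc ⟩ (~ ac)
  a10 : Arc ⟨ abc ⟩ ⟨ ab ⟩
  a11 : Arc ⟨ acb ⟩ (~ bc)
  a12 : Arc ⟨ acb ⟩ ⟨ ac ⟩
  a13 : Arc (~ id) ⟨ ac ⟩
  a14 : Arc (~ id) (~ bc)
  a15 : Arc (~ ab) ⟨ acb ⟩
  a16 : Arc (~ ab) (~ abc)
  a17 : Arc (~ ac) ⟨ id ⟩
  a18 : Arc (~ ac) (~ acb)
  a19 : Arc (~ bc) ⟨ abc ⟩
  a20 : Arc (~ bc) (~ id)
  a21 : Arc (~ abc) ⟨ bc ⟩
  a22 : Arc (~ abc) (~ ab)
  a23 : Arc (~ acb) ⟨ ab ⟩
  a24 : Arc (~ acb) (~ ac)

IsWalk : List V → Set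
IsWalk = Linked Arc

SquareFree : {A : Set} → List A → Set
SquareFree {A} w = ¬ ∃ λ (u : List A) → ∃ λ (y : List A) → ∃ λ (v : List A) →
  (y ≢ []) × (w ≡ u ++ y ++ y ++ v)

ExtremalSquareFree : List Γ → Set
ExtremalSquareFree u = SquareFree u ×
  (∀ (u' u'' : List Γ) (x : Γ) → u' ++ u'' ≡ u → ¬ SquareFree (u' ++ x ∷ u''))

twist : List Γ → V → List Γ
twist N ⟨ π ⟩ = map (act π) N
twist N (~ π) = reverse (map (act π) N)

data Letter : Set where
  vtx : V → Letter
  p   : V → Letter
  s   : V → Letter

wP : List Γ
wP = `a ∷ `b ∷ `a ∷ `c ∷ `b ∷ `c ∷ `a ∷ `b ∷ `c ∷ `b ∷ `a ∷ `c ∷ `a ∷ `b ∷ `a ∷ `c ∷ `b ∷ `c ∷ `a ∷ `b ∷ `c ∷ `b ∷ `a ∷ `b ∷ `c ∷ `a ∷ `c ∷ `b ∷ `c ∷ `a ∷ `b ∷ `c ∷ `b ∷ `a ∷ `c ∷ `a ∷ `b ∷ `a ∷ `c ∷ `b ∷ `c ∷ `a ∷ `b ∷ `c ∷ `b ∷ `a ∷ `c ∷ `b ∷ `c ∷ []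

wQ : List Γ
wQ = `a ∷ `b ∷ `a ∷ `c ∷ `b ∷ `a ∷ `b ∷ `c ∷ `a ∷ `c ∷ `b ∷ `a ∷ `c ∷ `a ∷ `b ∷ `a ∷ `c ∷ `b ∷ `c ∷ `a ∷ `c ∷ `b ∷ `a ∷ `c ∷ `a ∷ `b ∷ `c ∷ `b ∷ `a ∷ `b ∷ `c ∷ `a ∷ `b ∷ `a ∷ `c ∷ `b ∷ `c ∷ `a ∷ `b ∷ `c ∷ `b ∷ []

wR : List Γ
wR = `a ∷ `b ∷ `a ∷ `c ∷ `a ∷ `b ∷ `c ∷ `a ∷ `c ∷ `b ∷ `a ∷ `c ∷ `a ∷ `b ∷ `c ∷ `b ∷ `a ∷ `b ∷ `c ∷ `a ∷ `c ∷ `b ∷ `a ∷ `c ∷ `a ∷ `b ∷ `a ∷ `c ∷ `b ∷ `c ∷ `a ∷ `c ∷ `b ∷ `a ∷ `c ∷ `a ∷ `b ∷ `c ∷ `b ∷ `a ∷ `b ∷ `c ∷ `a ∷ `b ∷ `a ∷ `c ∷ `b ∷ `c ∷ `a ∷ `b ∷ `c ∷ `b ∷ []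

wS : List Γ
wS = `a ∷ `c ∷ `a ∷ `b ∷ `a ∷ `c ∷ `b ∷ `a ∷ `b ∷ `c ∷ `a ∷ `c ∷ `b ∷ `a ∷ `c ∷ `a ∷ `b ∷ `c ∷ `b ∷ `a ∷ `c ∷ `b ∷ `c ∷ `a ∷ `b ∷ `a ∷ `c ∷ `b ∷ `a ∷ `b ∷ `c ∷ `a ∷ `c ∷ `b ∷ `a ∷ `c ∷ `a ∷ `b ∷ `c ∷ `b ∷ `a ∷ `b ∷ `c ∷ `a ∷ `c ∷ `b ∷ `a ∷ `c ∷ `a ∷ []

-- δ on letters (a finite set of words, given as a list)
δ₁ : Letter → List (List Γ)
δ₁ (vtx x)     = (twist wQ (x)) ∷ (twist wR (x)) ∷ []
δ₁ (p ⟨ π ⟩)   = [ (twist wP (⟨ π ⟩)) ]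
δ₁ (s ⟨ π ⟩)   = [ (twist wS (⟨ π ⟩)) ]
δ₁ (p (~ π))   = [ (twist wS (~ π)) ]
δ₁ (s (~ π))   = [ (twist wP (~ π)) ]

δ : List Letter → List (List Γ)
δ []       = [ [] ]
δ (l ∷ ls) = concatMap (λ A → map (A ++_) (δ ls)) (δ₁ l)

-- Write an element u of δ(p_x w s_y) as the concatenation of its blocks, the images of single letters.
-- The 42-letter prefix of a block, its mark, occurs in the concatenation of two consecutive blocks only
-- at the block boundary, so the factorisation of u is determined by u. Take a square yy in u. If some
-- mark lies inside the first y, its copy in the second y is again a block start, the block boundaries
-- repeat with period |y|, and since 21-letter prefixes and suffixes of blocks determine their letters
-- (and 39-letter prefixes their lengths) the letter word p_x w s_y contains a square, hence so does w.
-- Otherwise yy lies within three consecutive blocks, and such triples are square-free by a finite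
-- check. Likewise, inserting a letter anywhere creates a square within 25 letters of the insertion
-- point, which is checked on all pairs and triples of consecutive blocks.

module Submission where

open import Defs
open import Data.Bool using (Bool; true; false; T; _∧_; _∨_; not)
open import Data.Bool.ListAction using (all; any)
open import Data.Bool.Properties using (T-≡; T-∨)
open import Data.Empty using (⊥; ⊥-elim)
open import Data.List using (List; []; _∷_; _++_; [_]; map; concat; concatMap; reverse; length; take; drop; upTo)
open import Data.List.Membership.Propositional using (_∈_; _∉_; find)
open import Data.List.Membership.Propositional.Properties
  using (∈-upTo⁺; ∈-map⁺; ∈-map⁻; ∈-++⁺ˡ; ∈-++⁺ʳ; ∈-++⁻; ∈-concatMap⁺; ∈-concatMap⁻)
open import Data.List.Properties
  using ( ++-assoc; length-++; length-++-≤ʳ; length-map; length-take; length-drop; map-++; map-∘; map-cong; map-id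
        ; drop-[]; take++drop≡id; take-all; drop-drop; drop-all; reverse-++; reverse-involutive; unfold-reverse; ∷-injectiveˡ)
open import Data.List.Relation.Unary.All using (lookup)
open import Data.List.Relation.Unary.All.Properties using (all⁺)
open import Data.List.Relation.Unary.Any using (Any; here; there)
import Data.List.Relation.Unary.Any as Any
open import Data.List.Relation.Unary.Any.Properties using (any⁻; reverse⁻)
open import Data.List.Relation.Unary.Linked using (Linked; []; [-]; _∷_)
open import Data.Nat
open import Data.Nat.Properties
open import Data.Nat.Tactic.RingSolver using (solve-∀)
open import Algebra.Properties.CommutativeSemigroup +-commutativeSemigroup using (xy∙z≈xz∙y)
open import Data.Product using (∃; _×_; _,_; proj₁; proj₂)
open import Data.Sum using (_⊎_; inj₁; inj₂; [_,_]′)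
open import Function.Base using (_∘_)
open import Function.Bundles using (Equivalence)
open import Relation.Binary.Definitions using (DecidableEquality)
open import Relation.Binary.PropositionalEquality using (_≡_; _≢_; refl; sym; trans; cong; cong₂; subst; subst₂; module ≡-Reasoning)
open import Relation.Nullary using (¬_)
open import Relation.Nullary.Decidable using (yes; no; isYes; map′; toWitness; fromWitness)

-- Squares

module _ {A : Set} where

  HasSquare : List A → Set
  HasSquare w = ∃ λ (u : List A) → ∃ λ (y : List A) → ∃ λ (v : List A) → (y ≢ []) × (w ≡ u ++ y ++ y ++ v)

  hasSquare-∷ : ∀ {c : A} {w} → HasSquare w → HasSquare (c ∷ w)
  hasSquare-∷ {c} (u , y , v , y≢[] , refl) = c ∷ u , y , v , y≢[] , refl

  hasSquare-infix : ∀ (L : List A) {w} R → HasSquare w → HasSquare (L ++ w ++ R)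
  hasSquare-infix L R (u , y , v , y≢[] , refl) = L ++ u , y , v ++ R , y≢[] , (begin
    L ++ (u ++ y ++ y ++ v) ++ R   ≡⟨ cong (L ++_) (++-assoc u _ R) ⟩
    L ++ u ++ (y ++ y ++ v) ++ R   ≡⟨ cong (λ z → L ++ u ++ z) (++-assoc y _ R) ⟩
    L ++ u ++ y ++ (y ++ v) ++ R   ≡⟨ cong (λ z → L ++ u ++ y ++ z) (++-assoc y v R) ⟩
    L ++ u ++ y ++ y ++ v ++ R     ≡⟨ ++-assoc L u _ ⟨
    (L ++ u) ++ y ++ y ++ v ++ R   ∎)
    where open ≡-Reasoning

  hasSquare-∷⁻ : ∀ {c w} → c ∉ w → HasSquare (c ∷ w) → HasSquare w
  hasSquare-∷⁻ c∉w ([] , [] , v , y≢[] , _) = ⊥-elim (y≢[] refl)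
  hasSquare-∷⁻ c∉w ([] , c ∷ y , v , y≢[] , refl) = ⊥-elim (c∉w (∈-++⁺ʳ y (here refl)))
  hasSquare-∷⁻ c∉w (c ∷ u , y , v , y≢[] , refl) = u , y , v , y≢[] , refl

  hasSquare-reverse : ∀ {w} → HasSquare w → HasSquare (reverse w)
  hasSquare-reverse (u , y , v , y≢[] , refl) = reverse v , reverse y , reverse u , ry≢[] , (begin
    reverse (u ++ y ++ y ++ v)                          ≡⟨ reverse-++ u _ ⟩
    reverse (y ++ y ++ v) ++ reverse u                  ≡⟨ cong (_++ reverse u) (reverse-++ y _) ⟩
    (reverse (y ++ v) ++ reverse y) ++ reverse u        ≡⟨ cong (λ z → (z ++ reverse y) ++ reverse u) (reverse-++ y v) ⟩
    ((reverse v ++ reverse y) ++ reverse y) ++ reverse u ≡⟨ ++-assoc (reverse v ++ reverse y) _ _ ⟩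
    (reverse v ++ reverse y) ++ reverse y ++ reverse u  ≡⟨ ++-assoc (reverse v) _ _ ⟩
    reverse v ++ reverse y ++ reverse y ++ reverse u    ∎)
    where
    open ≡-Reasoning
    ry≢[] : reverse y ≢ []
    ry≢[] e = y≢[] (trans (sym (reverse-involutive y)) (cong reverse e))

  hasSquare-∷ʳ⁻ : ∀ {c w} → c ∉ w → HasSquare (w ++ [ c ]) → HasSquare w
  hasSquare-∷ʳ⁻ {c} {w} c∉w square = subst HasSquare (reverse-involutive w) (hasSquare-reverse
    (hasSquare-∷⁻ (λ c∈rw → c∉w (reverse⁻ c∈rw)) (subst HasSquare (reverse-++ w [ c ]) (hasSquare-reverse square))))

  ≢[]⇒1≤length : ∀ {w : List A} → w ≢ [] → 1 ≤ length w
  ≢[]⇒1≤length {[]}    w≢[] = ⊥-elim (w≢[] refl)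
  ≢[]⇒1≤length {_ ∷ _} _    = s≤s z≤n

hasSquare-map : ∀ {A B : Set} (f : A → B) {w} → HasSquare w → HasSquare (map f w)
hasSquare-map f (u , y , v , y≢[] , refl) = map f u , map f y , map f v , fy≢[] y≢[] ,
  trans (map-++ f u _) (cong (map f u ++_) (trans (map-++ f y _) (cong (map f y ++_) (map-++ f y v))))
  where
  fy≢[] : ∀ {y} → y ≢ [] → map f y ≢ []
  fy≢[] {[]} y≢[] = ⊥-elim (y≢[] refl)
  fy≢[] {_ ∷ _} _ ()

hasSquare-map⁻ : ∀ {A B : Set} {f : A → B} (g : B → A) → (∀ x → g (f x) ≡ x) → ∀ {w} → HasSquare (map f w) → HasSquare w
hasSquare-map⁻ {f = f} g g∘f≡id {w} square = subst HasSquare (trans (sym (map-∘ w)) (trans (map-cong g∘f≡id w) (map-id w))) (hasSquare-map g square)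

module _ {A : Set} where

  ++-assoc₃ : ∀ (a b c d : List A) → (a ++ b ++ c) ++ d ≡ a ++ b ++ c ++ d
  ++-assoc₃ a b c d = trans (++-assoc a (b ++ c) d) (cong (a ++_) (++-assoc b c d))

  take-++ˡ : ∀ n (xs ys : List A) → n ≤ length xs → take n (xs ++ ys) ≡ take n xs
  take-++ˡ zero    xs       ys _         = refl
  take-++ˡ (suc n) (x ∷ xs) ys (s≤s n≤) = cong (x ∷_) (take-++ˡ n xs ys n≤)

  take-++ : ∀ n (xs ys : List A) → take n (xs ++ ys) ≡ take n xs ++ take (n ∸ length xs) ys
  take-++ zero    xs       ys = cong (λ k → take k ys) (sym (0∸n≡0 (length xs)))
  take-++ (suc n) []       ys = refl
  take-++ (suc n) (x ∷ xs) ys = cong (x ∷_) (take-++ n xs ys)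

  take-length-++ : ∀ (xs : List A) ys n → take (length xs + n) (xs ++ ys) ≡ xs ++ take n ys
  take-length-++ []       ys n = refl
  take-length-++ (x ∷ xs) ys n = cong (x ∷_) (take-length-++ xs ys n)

  take-length : ∀ (xs ys : List A) → take (length xs) (xs ++ ys) ≡ xs
  take-length []       ys = refl
  take-length (x ∷ xs) ys = cong (x ∷_) (take-length xs ys)

  drop-++ˡ : ∀ n (xs ys : List A) → n ≤ length xs → drop n (xs ++ ys) ≡ drop n xs ++ ys
  drop-++ˡ zero    xs       ys _         = refl
  drop-++ˡ (suc n) (x ∷ xs) ys (s≤s n≤) = drop-++ˡ n xs ys n≤

  drop-length-++ : ∀ (xs : List A) ys n → drop (length xs + n) (xs ++ ys) ≡ drop n ys
  drop-length-++ []       ys n = refl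
  drop-length-++ (x ∷ xs) ys n = drop-length-++ xs ys n

  drop-length : ∀ (xs ys : List A) → drop (length xs) (xs ++ ys) ≡ ys
  drop-length []       ys = refl
  drop-length (x ∷ xs) ys = drop-length xs ys

  drop-∷-drop : ∀ l (w : List A) → l < length w → ∃ λ c → drop l w ≡ c ∷ drop (suc l) w
  drop-∷-drop zero    (c ∷ w) _         = c , refl
  drop-∷-drop (suc l) (c ∷ w) (s≤s l<) = drop-∷-drop l w l<

  drop-suc : ∀ l (w : List A) {c rest} → drop l w ≡ c ∷ rest → drop (suc l) w ≡ rest
  drop-suc l w drop≡ = trans (cong (λ k → drop k w) (+-comm 1 l)) (trans (sym (drop-drop l 1 w)) (cong (drop 1) drop≡))

  lookupOr : A → List A → ℕ → A
  lookupOr d []       _       = d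
  lookupOr d (x ∷ xs) zero    = x
  lookupOr d (x ∷ xs) (suc k) = lookupOr d xs k

  lookupOr-take : ∀ d (xs : List A) {m k} → k < m → lookupOr d (take m xs) k ≡ lookupOr d xs k
  lookupOr-take d []       {suc m}         _         = refl
  lookupOr-take d (x ∷ xs) {suc m} {zero}  _         = refl
  lookupOr-take d (x ∷ xs) {suc m} {suc k} (s≤s k<m) = lookupOr-take d xs k<m

  lookupOr-drop : ∀ d (xs : List A) m k → lookupOr d (drop m xs) k ≡ lookupOr d xs (m + k)
  lookupOr-drop d xs       zero    k = refl
  lookupOr-drop d []       (suc m) k = refl
  lookupOr-drop d (x ∷ xs) (suc m) k = lookupOr-drop d xs m k

  lookupOr-last : ∀ d (xs : List A) z → lookupOr d (xs ++ z ∷ []) (length xs) ≡ z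
  lookupOr-last d []       z = refl
  lookupOr-last d (x ∷ xs) z = lookupOr-last d xs z

  lookupOr-injective : ∀ d (xs ys : List A) {n} → length xs ≡ n → length ys ≡ n →
                       (∀ j → j < n → lookupOr d xs j ≡ lookupOr d ys j) → xs ≡ ys
  lookupOr-injective d []       []       _    _    _    = refl
  lookupOr-injective d []       (y ∷ ys) refl ()
  lookupOr-injective d (x ∷ xs) []       refl ()
  lookupOr-injective d (x ∷ xs) (y ∷ ys) refl |ys| same =
    cong₂ _∷_ (same 0 z<s) (lookupOr-injective d xs ys refl (suc-injective |ys|) (λ j j< → same (suc j) (s≤s j<)))

  linked-lookupOr : ∀ {R : A → A → Set} d {xs} → Linked R xs → ∀ {k} → suc k < length xs → R (lookupOr d xs k) (lookupOr d xs (suc k))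
  linked-lookupOr d [-]        {k}     (s≤s ())
  linked-lookupOr d (r ∷ _)    {zero}  _          = r
  linked-lookupOr d (_ ∷ rest) {suc k} (s≤s 2+k<) = linked-lookupOr d rest 2+k<

module _ {A : Set} where

  halves⇒hasSquare : ∀ l (w : List A) → 1 ≤ l → l + l ≤ length w → take l w ≡ take l (drop l w) → HasSquare w
  halves⇒hasSquare l w 1≤l l+l≤ halves = [] , y , rest , y≢[] , (begin
    w                                ≡⟨ take++drop≡id l w ⟨
    y ++ drop l w                    ≡⟨ cong (y ++_) (take++drop≡id l (drop l w)) ⟨
    y ++ take l (drop l w) ++ rest   ≡⟨ cong (λ z → y ++ z ++ rest) halves ⟨
    y ++ y ++ rest                   ∎)
    where
    open ≡-Reasoning
    y rest : List A
    y = take l w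
    rest = drop l (drop l w)
    y≢[] : y ≢ []
    y≢[] y≡[] = <⇒≱ 1≤l (≤-reflexive (trans (sym (trans (length-take l w) (m≤n⇒m⊓n≡m (≤-trans (m≤m+n l l) l+l≤)))) (cong length y≡[])))

  periodic⇒hasSquare : ∀ d (xs : List A) k e → 1 ≤ e → k + (e + e) ≤ length xs →
                       (∀ j → j < e → lookupOr d xs (k + j) ≡ lookupOr d xs (k + e + j)) → HasSquare xs
  periodic⇒hasSquare d xs       zero    e 1≤e fits same = halves⇒hasSquare e xs 1≤e fits
    (lookupOr-injective d (take e xs) (take e (drop e xs)) (|take-e| xs (≤-trans (m≤m+n e e) fits))
      (|take-e| (drop e xs) (subst (e ≤_) (sym (length-drop e xs)) (m+n≤o⇒m≤o∸n e fits)))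
      (λ j j<e → trans (lookupOr-take d xs j<e) (trans (same j j<e)
                   (sym (trans (lookupOr-take d (drop e xs) j<e) (lookupOr-drop d xs e j))))))
    where
    |take-e| : ∀ ys → e ≤ length ys → length (take e ys) ≡ e
    |take-e| ys e≤ = trans (length-take e ys) (m≤n⇒m⊓n≡m e≤)
  periodic⇒hasSquare d (x ∷ xs) (suc k) e 1≤e (s≤s fits) same = hasSquare-∷ (periodic⇒hasSquare d xs k e 1≤e fits same)

  length-square : ∀ (α y β : List A) → length (α ++ y ++ y ++ β) ≡ length α + (length y + length y + length β)
  length-square α y β = trans (length-++ α) (cong (length α +_) (trans (length-++ y)
    (trans (cong (length y +_) (length-++ y)) (sym (+-assoc (length y) (length y) (length β))))))

  <-length-square : ∀ (y v : List A) {k l} → length y ≡ suc (k + l) → l < length (y ++ y ++ v)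
  <-length-square y v {k} {l} |y|≡ = ≤-trans (s≤s (m≤n+m l k))
    (subst (_≤ length (y ++ y ++ v)) |y|≡ (subst (length y ≤_) (sym (length-++ y)) (m≤m+n (length y) _)))

  window : List A → ℕ → ℕ → List A
  window u t n = take n (drop t u)

  window-in-factor : ∀ (pre w post : List A) r n → r + n ≤ length w →
                     window (pre ++ w ++ post) (length pre + r) n ≡ take n (drop r w)
  window-in-factor pre w post r n r+n≤ = begin
    take n (drop (length pre + r) (pre ++ w ++ post))  ≡⟨ cong (take n) (drop-length-++ pre (w ++ post) r) ⟩
    take n (drop r (w ++ post))                        ≡⟨ cong (take n) (drop-++ˡ r w post (≤-trans (m≤m+n r n) r+n≤)) ⟩
    take n (drop r w ++ post)                          ≡⟨ take-++ˡ n (drop r w) post n≤ ⟩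
    take n (drop r w)                                  ∎
    where
    open ≡-Reasoning
    n≤ : n ≤ length (drop r w)
    n≤ = subst (n ≤_) (sym (length-drop r w)) (m+n≤o⇒m≤o∸n n (subst (_≤ length w) (+-comm r n) r+n≤))

  window-square : ∀ (α y β : List A) t n → length α ≤ t → t + n ≤ length α + length y →
                  window (α ++ y ++ y ++ β) t n ≡ window (α ++ y ++ y ++ β) (t + length y) n
  window-square α y β t n α≤t t+n≤ = begin
    window (α ++ y ++ y ++ β) t n                          ≡⟨ cong (λ m → window _ m n) t≡ ⟨
    window (α ++ y ++ y ++ β) (length α + r) n             ≡⟨ window-in-factor α y (y ++ β) r n r+n≤ ⟩
    take n (drop r y)                                      ≡⟨ window-in-factor (α ++ y) y β r n r+n≤ ⟨
    window ((α ++ y) ++ y ++ β) (length (α ++ y) + r) n    ≡⟨ cong₂ (λ z m → window z m n) (++-assoc α y (y ++ β)) t+ℓ≡ ⟩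
    window (α ++ y ++ y ++ β) (t + length y) n             ∎
    where
    open ≡-Reasoning
    r : ℕ
    r = t ∸ length α
    t≡ : length α + r ≡ t
    t≡ = m+[n∸m]≡n α≤t
    r+n≤ : r + n ≤ length y
    r+n≤ = +-cancelˡ-≤ (length α) (r + n) (length y) (subst (_≤ length α + length y) (trans (cong (_+ n) (sym t≡)) (+-assoc (length α) r n)) t+n≤)
    t+ℓ≡ : length (α ++ y) + r ≡ t + length y
    t+ℓ≡ = trans (cong (_+ r) (length-++ α)) (trans (xy∙z≈xz∙y (length α) (length y) r) (cong (_+ length y) t≡))

  hasSquare-window : ∀ (α y β : List A) i n → y ≢ [] → i ≤ length α → length α + (length y + length y) ≤ i + n →
                     HasSquare (window (α ++ y ++ y ++ β) i n)
  hasSquare-window α y β i n y≢[] i≤ fits = α′ , y , take m β , y≢[] , (begin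
    take n (drop i (α ++ y ++ y ++ β))     ≡⟨ cong (take n) (drop-++ˡ i α (y ++ y ++ β) i≤) ⟩
    take n (α′ ++ y ++ y ++ β)             ≡⟨ cong (take n) (++-assoc₃ α′ y y β) ⟨
    take n ((α′ ++ y ++ y) ++ β)           ≡⟨ cong (λ k → take k _) n≡ ⟨
    take (length (α′ ++ y ++ y) + m) ((α′ ++ y ++ y) ++ β) ≡⟨ take-length-++ (α′ ++ y ++ y) β m ⟩
    (α′ ++ y ++ y) ++ take m β             ≡⟨ ++-assoc₃ α′ y y (take m β) ⟩
    α′ ++ y ++ y ++ take m β               ∎)
    where
    open ≡-Reasoning
    α′ : List A
    α′ = drop i α
    m : ℕ
    m = n ∸ length (α′ ++ y ++ y)
    n≡ : length (α′ ++ y ++ y) + m ≡ n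
    n≡ = m+[n∸m]≡n (+-cancelˡ-≤ i _ n (subst (_≤ i + n) (begin
      length α + (length y + length y)             ≡⟨ cong (_+ _) (m+[n∸m]≡n i≤) ⟨
      i + (length α ∸ i) + (length y + length y)   ≡⟨ +-assoc i (length α ∸ i) _ ⟩
      i + ((length α ∸ i) + (length y + length y)) ≡⟨ cong (i +_) (trans (cong₂ _+_ (sym (length-drop i α)) (sym (length-++ y))) (sym (length-++ α′))) ⟩
      i + length (α′ ++ y ++ y)                    ∎) fits))

  hasSquare-insertion : ∀ (pre L B C post : List A) o x → o ≤ length B →
                        HasSquare ((L ++ take o B) ++ x ∷ drop o B ++ C) →
                        let t = length pre + length L + o; w = pre ++ L ++ B ++ C ++ post in
                        HasSquare (take t w ++ x ∷ drop t w)
  hasSquare-insertion pre L B C post o x o≤ square = subst HasSquare (sym extended≡) (hasSquare-infix pre post square)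
    where
    open ≡-Reasoning
    t : ℕ
    t = length pre + length L + o
    w : List A
    w = pre ++ L ++ B ++ C ++ post
    take≡ : take t w ≡ pre ++ L ++ take o B
    take≡ = begin
      take t w                                         ≡⟨ cong (λ n → take n w) (+-assoc (length pre) (length L) o) ⟩
      take (length pre + (length L + o)) w             ≡⟨ take-length-++ pre _ (length L + o) ⟩
      pre ++ take (length L + o) (L ++ B ++ C ++ post) ≡⟨ cong (pre ++_) (take-length-++ L _ o) ⟩
      pre ++ L ++ take o (B ++ C ++ post)              ≡⟨ cong (λ v → pre ++ L ++ v) (take-++ˡ o B _ o≤) ⟩
      pre ++ L ++ take o B                             ∎
    drop≡ : drop t w ≡ drop o B ++ C ++ post
    drop≡ = begin
      drop t w                                         ≡⟨ cong (λ n → drop n w) (+-assoc (length pre) (length L) o) ⟩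
      drop (length pre + (length L + o)) w             ≡⟨ drop-length-++ pre _ (length L + o) ⟩
      drop (length L + o) (L ++ B ++ C ++ post)        ≡⟨ drop-length-++ L _ o ⟩
      drop o (B ++ C ++ post)                          ≡⟨ drop-++ˡ o B _ o≤ ⟩
      drop o B ++ C ++ post                            ∎
    extended≡ : take t w ++ x ∷ drop t w ≡ pre ++ ((L ++ take o B) ++ x ∷ drop o B ++ C) ++ post
    extended≡ = begin
      take t w ++ x ∷ drop t w                         ≡⟨ cong₂ (λ v v′ → v ++ x ∷ v′) take≡ drop≡ ⟩
      (pre ++ L ++ take o B) ++ x ∷ drop o B ++ C ++ post ≡⟨ ++-assoc pre (L ++ take o B) _ ⟩
      pre ++ (L ++ take o B) ++ x ∷ drop o B ++ C ++ post ≡⟨ cong (λ v → pre ++ (L ++ take o B) ++ x ∷ v) (++-assoc (drop o B) C post) ⟨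
      pre ++ (L ++ take o B) ++ (x ∷ drop o B ++ C) ++ post ≡⟨ cong (pre ++_) (++-assoc (L ++ take o B) _ post) ⟨
      pre ++ ((L ++ take o B) ++ x ∷ drop o B ++ C) ++ post ∎

lookupOr-map : ∀ {A B : Set} (f : A → B) d (xs : List A) k → lookupOr (f d) (map f xs) k ≡ f (lookupOr d xs k)
lookupOr-map f d []       k       = refl
lookupOr-map f d (x ∷ xs) zero    = refl
lookupOr-map f d (x ∷ xs) (suc k) = lookupOr-map f d xs k

module _ {A : Set} where

  wordStart : List A → List (List A) → ℕ → ℕ
  wordStart d ws zero    = 0
  wordStart d ws (suc k) = wordStart d ws k + length (lookupOr d ws k)

  wordStart-∷ : ∀ d w ws k → wordStart d (w ∷ ws) (suc k) ≡ length w + wordStart d ws k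
  wordStart-∷ d w ws zero    = sym (+-identityʳ (length w))
  wordStart-∷ d w ws (suc k) = trans (cong (_+ length (lookupOr d ws k)) (wordStart-∷ d w ws k)) (+-assoc (length w) _ _)

  drop-wordStart : ∀ d ws k → k ≤ length ws → drop (wordStart d ws k) (concat ws) ≡ concat (drop k ws)
  drop-wordStart d ws       zero    _         = refl
  drop-wordStart d (w ∷ ws) (suc k) (s≤s k≤) = begin
    drop (wordStart d (w ∷ ws) (suc k)) (w ++ concat ws) ≡⟨ cong (λ n → drop n (w ++ concat ws)) (wordStart-∷ d w ws k) ⟩
    drop (length w + wordStart d ws k) (w ++ concat ws)  ≡⟨ drop-length-++ w (concat ws) (wordStart d ws k) ⟩
    drop (wordStart d ws k) (concat ws)                  ≡⟨ drop-wordStart d ws k k≤ ⟩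
    concat (drop k ws)                                   ∎
    where open ≡-Reasoning

  length-concat : ∀ d ws → length (concat ws) ≡ wordStart d ws (length ws)
  length-concat d []       = refl
  length-concat d (w ∷ ws) = trans (length-++ w) (trans (cong (length w +_) (length-concat d ws)) (sym (wordStart-∷ d w ws (length ws))))

  drop-wordStart-lookupOr : ∀ d ws k → k < length ws →
                            drop (wordStart d ws k) (concat ws) ≡ lookupOr d ws k ++ drop (wordStart d ws (suc k)) (concat ws)
  drop-wordStart-lookupOr d ws k k< = trans (drop-wordStart d ws k (<⇒≤ k<)) (trans (cong concat (drop-lookupOr ws k k<))
    (cong (lookupOr d ws k ++_) (sym (drop-wordStart d ws (suc k) k<))))
    where
    drop-lookupOr : ∀ (xs : List (List A)) k → k < length xs → drop k xs ≡ lookupOr d xs k ∷ drop (suc k) xs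
    drop-lookupOr (x ∷ xs) zero    _         = refl
    drop-lookupOr (x ∷ xs) (suc k) (s≤s k<) = drop-lookupOr xs k k<

-- Deciding square-freeness

T-∧ˡ : ∀ {a b} → T (a ∧ b) → T a
T-∧ˡ {true} _ = _

T-∧ʳ : ∀ {a b} → T (a ∧ b) → T b
T-∧ʳ {true} t = t

T-∧⁺ : ∀ {a b} → T a → T b → T (a ∧ b)
T-∧⁺ {true} _ t = t

T-not⁻ : ∀ {a} → T (not a) → T a → ⊥
T-not⁻ {false} _ ()

module Decide {A : Set} (_≟_ : DecidableEquality A) where

  _==_ : List A → List A → Bool
  []       == []       = true
  (x ∷ xs) == (y ∷ ys) = isYes (x ≟ y) ∧ (xs == ys)
  _        == _        = false

  ==-refl : ∀ xs → T (xs == xs)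
  ==-refl []       = _
  ==-refl (x ∷ xs) = T-∧⁺ (fromWitness {a? = x ≟ x} refl) (==-refl xs)

  isPrefix? : List A → List A → Bool
  isPrefix? []       _        = true
  isPrefix? (_ ∷ _)  []       = false
  isPrefix? (x ∷ xs) (y ∷ ys) = isYes (x ≟ y) ∧ isPrefix? xs ys

  isPrefix?-sound : ∀ xs ys → T (isPrefix? xs ys) → ∃ λ r → ys ≡ xs ++ r
  isPrefix?-sound []       ys       _     = ys , refl
  isPrefix?-sound (x ∷ xs) (y ∷ ys) found with isPrefix?-sound xs ys (T-∧ʳ {isYes (x ≟ y)} found)
  ... | r , ys≡ = r , cong₂ _∷_ (sym (toWitness {a? = x ≟ y} (T-∧ˡ found))) ys≡

  isPrefix?-complete : ∀ xs r → T (isPrefix? xs (xs ++ r))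
  isPrefix?-complete []       r = _
  isPrefix?-complete (x ∷ xs) r = T-∧⁺ (fromWitness {a? = x ≟ x} refl) (isPrefix?-complete xs r)

  -- Invariant: rest = drop l w. Tries the half-lengths l + 1, …, l + n; carrying rest along instead of
  -- recomputing drop keeps each test cheap.

  squarePrefix? : ℕ → ℕ → List A → List A → Bool
  squarePrefix? zero    l w rest       = false
  squarePrefix? (suc n) l w []         = false
  squarePrefix? (suc n) l w (_ ∷ rest) = isPrefix? (take (suc l) w) rest ∨ squarePrefix? n (suc l) w rest

  squarePrefix?-sound : ∀ n l w rest → drop l w ≡ rest → T (squarePrefix? n l w rest) → HasSquare w
  squarePrefix?-sound (suc n) l []        (c ∷ rest) drop≡ found with trans (sym (drop-[] l)) drop≡
  ... | ()
  squarePrefix?-sound (suc n) l w@(_ ∷ _) (c ∷ rest) drop≡ found with Equivalence.to T-∨ found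
  ... | inj₁ prefix = [] , take (suc l) w , r , (λ ()) , (begin
    w                                    ≡⟨ take++drop≡id (suc l) w ⟨
    take (suc l) w ++ drop (suc l) w     ≡⟨ cong (take (suc l) w ++_) (trans (drop-suc l w drop≡) rest≡) ⟩
    take (suc l) w ++ take (suc l) w ++ r ∎)
    where
    open ≡-Reasoning
    r : List A
    r = proj₁ (isPrefix?-sound (take (suc l) w) rest prefix)
    rest≡ : rest ≡ take (suc l) w ++ r
    rest≡ = proj₂ (isPrefix?-sound (take (suc l) w) rest prefix)
  ... | inj₂ later = squarePrefix?-sound n (suc l) w rest (drop-suc l w drop≡) later

  squarePrefix?-complete : ∀ k n l y v → length y ≡ suc (k + l) → k < n → T (squarePrefix? n l (y ++ y ++ v) (drop l (y ++ y ++ v)))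
  squarePrefix?-complete zero (suc n) l y v |y|≡ _ with drop-∷-drop l (y ++ y ++ v) (<-length-square y v |y|≡)
  ... | c , drop≡ rewrite drop≡ = Equivalence.from T-∨ (inj₁ (subst₂ (λ a b → T (isPrefix? a b)) take≡ drop≡′ (isPrefix?-complete y v)))
    where
    take≡ : y ≡ take (suc l) (y ++ y ++ v)
    take≡ = trans (sym (take-length y (y ++ v))) (cong (λ m → take m (y ++ y ++ v)) |y|≡)
    drop≡′ : y ++ v ≡ drop (suc l) (y ++ y ++ v)
    drop≡′ = trans (sym (drop-length y (y ++ v))) (cong (λ m → drop m (y ++ y ++ v)) |y|≡)
  squarePrefix?-complete (suc k) (suc n) l y v |y|≡ (s≤s k<n) with drop-∷-drop l (y ++ y ++ v) (<-length-square y v |y|≡)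
  ... | c , drop≡ rewrite drop≡ = Equivalence.from T-∨ (inj₂ (squarePrefix?-complete k n (suc l) y v (trans |y|≡ (cong suc (sym (+-suc k l)))) k<n))

  squareFree? : List A → Bool
  squareFree? []      = true
  squareFree? (c ∷ w) = not (squarePrefix? (length (c ∷ w)) 0 (c ∷ w) (c ∷ w)) ∧ squareFree? w

  squareFree?-sound : ∀ w → T (squareFree? w) → SquareFree w
  squareFree?-sound w sf ([] , [] , v , y≢[] , _) = y≢[] refl
  squareFree?-sound w sf ([] , y@(c ∷ y′) , v , _ , refl) =
    T-not⁻ {squarePrefix? (length (y ++ y ++ v)) 0 (y ++ y ++ v) (y ++ y ++ v)} (T-∧ˡ sf)
      (squarePrefix?-complete (length y′) (length (y ++ y ++ v)) 0 y v (cong suc (sym (+-identityʳ (length y′)))) length-y′<)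
    where
    length-y′< : length y′ < length (y ++ y ++ v)
    length-y′< = s≤s (subst (length y′ ≤_) (sym (length-++ y′)) (m≤m+n (length y′) (length (y ++ v))))
  squareFree?-sound (c ∷ w) sf (c ∷ u , y , v , y≢[] , refl) = squareFree?-sound w (T-∧ʳ sf) (u , y , v , y≢[] , refl)

  suffixesWithin : ℕ → List A → List A → List (List A)
  suffixesWithin zero    cs       R = []
  suffixesWithin (suc n) []       R = [ R ]
  suffixesWithin (suc n) (c ∷ cs) R = R ∷ suffixesWithin n cs (c ∷ R)

  suffixesWithin-suffix : ∀ n cs R {S} → S ∈ suffixesWithin n cs R → ∃ λ L → reverse cs ++ R ≡ L ++ S
  suffixesWithin-suffix (suc n) []       R (here refl) = [] , refl
  suffixesWithin-suffix (suc n) (c ∷ cs) R (here refl) = reverse (c ∷ cs) , refl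
  suffixesWithin-suffix (suc n) (c ∷ cs) R (there S∈) with suffixesWithin-suffix n cs (c ∷ R) S∈
  ... | L , eq = L , trans (cong (_++ R) (unfold-reverse c cs)) (trans (++-assoc (reverse cs) [ c ] R) eq)

  startsWithShortSquare? : ℕ → List A → Bool
  startsWithShortSquare? r S = squarePrefix? r 0 S S

  squareNearʳ? : ℕ → List A → List A → Bool
  squareNearʳ? r cs R = any (startsWithShortSquare? r) (suffixesWithin (r + r) cs R)

  squareNear? : ℕ → List A → List A → Bool
  squareNear? r L R = squareNearʳ? r (reverse L) R

  squareNear?-sound : ∀ r L R → T (squareNear? r L R) → HasSquare (L ++ R)
  squareNear?-sound r L R found =
    let S , S∈ , found-S = find (any⁻ (startsWithShortSquare? r) (suffixesWithin (r + r) (reverse L) R) found)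
        L′ , L++R≡L′++S = suffixesWithin-suffix (r + r) (reverse L) R S∈
        u , y , v , y≢[] , S≡uyyv = squarePrefix?-sound r 0 S S refl found-S
    in L′ ++ u , y , v , y≢[] , (begin
      L ++ R                   ≡⟨ cong (_++ R) (reverse-involutive L) ⟨
      reverse (reverse L) ++ R ≡⟨ L++R≡L′++S ⟩
      L′ ++ S                  ≡⟨ cong (L′ ++_) S≡uyyv ⟩
      L′ ++ u ++ y ++ y ++ v   ≡⟨ ++-assoc L′ u _ ⟨
      (L′ ++ u) ++ y ++ y ++ v ∎)
    where open ≡-Reasoning

-- Synchronising factorisations

module StartPositions (start len : ℕ → ℕ) (start-zero : start 0 ≡ 0)
                      (start-suc : ∀ k → start (suc k) ≡ start k + len k)
                      (len≥41 : ∀ k → 41 ≤ len k) where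

  start-gap : ∀ k → start k + 41 ≤ start (suc k)
  start-gap k = subst (start k + 41 ≤_) (sym (start-suc k)) (+-monoʳ-≤ (start k) (len≥41 k))

  start-<-suc : ∀ k → start k < start (suc k)
  start-<-suc k = <-≤-trans (m<m+n (start k) {41} z<s) (start-gap k)

  start-mono-≤ : ∀ {a b} → a ≤ b → start a ≤ start b
  start-mono-≤ = go ∘ ≤⇒≤′
    where
    go : ∀ {a b} → a ≤′ b → start a ≤ start b
    go ≤′-refl        = ≤-refl
    go (≤′-step a≤′b) = ≤-trans (go a≤′b) (<⇒≤ (start-<-suc _))

  start-gap-< : ∀ {a b} → a < b → start a + 41 ≤ start b
  start-gap-< {a} a<b = ≤-trans (start-gap a) (start-mono-≤ a<b)

  start-cancel-< : ∀ {a b} → start a < start b → a < b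
  start-cancel-< {a} {b} sa<sb with a <? b
  ... | yes a<b = a<b
  ... | no a≮b  = ⊥-elim (<⇒≱ sa<sb (start-mono-≤ (≮⇒≥ a≮b)))

  block-containing : ∀ n t → t < start n → ∃ λ k → k < n × start k ≤ t × t < start (suc k)
  block-containing zero    t t<s0 = ⊥-elim (<⇒≱ t<s0 (subst (_≤ t) (sym start-zero) z≤n))
  block-containing (suc n) t t<sn with t <? start n
  ... | yes t<s = let k , k<n , sk≤t , t<sk+1 = block-containing n t t<s in k , m<n⇒m<1+n k<n , sk≤t , t<sk+1
  ... | no t≮s  = n , ≤-refl , ≮⇒≥ t≮s , t<sn

  first-start-≥ : ∀ i n → i ≤ start n → ∃ λ k → i ≤ start k × (∀ j → j < k → start j < i)
  first-start-≥ i zero    i≤s0 = zero , i≤s0 , λ _ ()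
  first-start-≥ i (suc n) i≤sn with i ≤? start n
  ... | yes i≤s = first-start-≥ i n i≤s
  ... | no i≰s  = suc n , i≤sn , λ j j<n+1 → ≤-<-trans (start-mono-≤ (≤-pred j<n+1)) (≰⇒> i≰s)

-- The constants are those of the blocks of δ: marks have 42 letters, blocks at least 41, and prefixes
-- and suffixes of 21 letters determine the class of a block (its letter), prefixes of 39 its length.
module Synchronisation {A C : Set} (u : List A) (N : ℕ) (3≤N : 3 ≤ N)
    (start len : ℕ → ℕ) (start-zero : start 0 ≡ 0) (start-suc : ∀ k → start (suc k) ≡ start k + len k)
    (len≥41 : ∀ k → 41 ≤ len k) (length-u : length u ≡ start N)
    (IsMark : List A → Set)
    (mark-at-start : ∀ k → k < N → IsMark (window u (start k) 42))
    (mark⇒start : ∀ t → IsMark (window u t 42) → ∃ λ k → k < N × start k ≡ t)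
    (class : ℕ → C)
    (prefix⇒class : ∀ {k k′} → k < N → k′ < N → window u (start k) 21 ≡ window u (start k′) 21 → class k ≡ class k′)
    (suffix⇒class : ∀ {k k′ t t′} → k < N → k′ < N → t + 21 ≡ start (suc k) → t′ + 21 ≡ start (suc k′) →
                    window u t 21 ≡ window u t′ 21 → class k ≡ class k′)
    (prefix⇒len : ∀ {k k′} → k < N → k′ < N → window u (start k) 39 ≡ window u (start k′) 39 → len k ≡ len k′)
  where

  open StartPositions start len start-zero start-suc len≥41

  ClassSquare : Set
  ClassSquare = ∃ λ k → ∃ λ d → 1 ≤ d × k + (d + d) ≤ N × (∀ j → j < d → class (k + j) ≡ class (k + d + j))

  module Square (i ℓ : ℕ) (1≤ℓ : 1 ≤ ℓ) (fits : i + ℓ + ℓ ≤ start N)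
                (periodic : ∀ t n → i ≤ t → t + n ≤ i + ℓ → window u t n ≡ window u (t + ℓ) n) where

    Early : ℕ → Set
    Early k = start k + 42 ≤ i + ℓ

    start<N : ∀ {k} → start k < start N → k < N
    start<N = start-cancel-<

    early⇒<N : ∀ {k} → Early k → k < N
    early⇒<N early = start<N (<-≤-trans (m<m+n _ z<s) (≤-trans early (≤-trans (m≤m+n (i + ℓ) ℓ) fits)))

    early-shift<N : ∀ {k} → Early k → start k + ℓ < start N
    early-shift<N {k} early = <-≤-trans (m<m+n (start k + ℓ) {42} z<s)
      (≤-trans (subst (_≤ i + ℓ + ℓ) (xy∙z≈xz∙y (start k) 42 ℓ) (+-monoˡ-≤ ℓ early)) fits)

    early-prefix : ∀ {k} n → n ≤ 42 → Early k → start k + n ≤ i + ℓ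
    early-prefix {k} n n≤42 early = ≤-trans (+-monoʳ-≤ (start k) n≤42) early

    shift-start : ∀ k → i ≤ start k → Early k → ∃ λ k′ → k′ < N × start k′ ≡ start k + ℓ
    shift-start k i≤ early = mark⇒start (start k + ℓ)
      (subst IsMark (periodic (start k) 42 i≤ early) (mark-at-start k (early⇒<N early)))

    unshift-start : ∀ k′ → k′ < N → i + ℓ ≤ start k′ → start k′ + 42 ≤ i + ℓ + ℓ →
                    ∃ λ k → k < N × start k + ℓ ≡ start k′
    unshift-start k′ k′<N i+ℓ≤ fits42 =
      let k , k<N , start-k≡t = mark⇒start t (subst IsMark (sym (trans (periodic t 42 i≤t t+42≤) (cong (λ z → window u z 42) t+ℓ≡)))
                                                            (mark-at-start k′ k′<N))
      in k , k<N , trans (cong (_+ ℓ) start-k≡t) t+ℓ≡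
      where
      t : ℕ
      t = start k′ ∸ ℓ
      t+ℓ≡ : t + ℓ ≡ start k′
      t+ℓ≡ = m∸n+n≡m (≤-trans (m≤n+m ℓ i) i+ℓ≤)
      i≤t : i ≤ t
      i≤t = +-cancelʳ-≤ ℓ i t (subst (i + ℓ ≤_) (sym t+ℓ≡) i+ℓ≤)
      t+42≤ : t + 42 ≤ i + ℓ
      t+42≤ = +-cancelʳ-≤ ℓ (t + 42) (i + ℓ) (subst (_≤ i + ℓ + ℓ) (trans (cong (_+ 42) (sym t+ℓ≡)) (xy∙z≈xz∙y t ℓ 42)) fits42)

    i≤start-N : i ≤ start N
    i≤start-N = ≤-trans (m≤m+n i ℓ) (≤-trans (m≤m+n (i + ℓ) ℓ) fits)

    k₀ : ℕ
    k₀ = proj₁ (first-start-≥ i N i≤start-N)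

    i≤start-k₀ : i ≤ start k₀
    i≤start-k₀ = proj₁ (proj₂ (first-start-≥ i N i≤start-N))

    start-k₀-least : ∀ k → i ≤ start k → start k₀ ≤ start k
    start-k₀-least k i≤ with k₀ ≤? k
    ... | yes k₀≤k = start-mono-≤ k₀≤k
    ... | no k₀≰k  = ⊥-elim (<⇒≱ (proj₂ (proj₂ (first-start-≥ i N i≤start-N)) k (≰⇒> k₀≰k)) i≤)

    i≤start-k₀+ : ∀ j → i ≤ start (k₀ + j)
    i≤start-k₀+ j = ≤-trans i≤start-k₀ (start-mono-≤ (m≤m+n k₀ j))

    module EarlyMark (early-k₀ : Early k₀) where

      k₁ : ℕ
      k₁ = proj₁ (shift-start k₀ i≤start-k₀ early-k₀)

      start-k₁ : start k₁ ≡ start k₀ + ℓ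
      start-k₁ = proj₂ (proj₂ (shift-start k₀ i≤start-k₀ early-k₀))

      d : ℕ
      d = k₁ ∸ suc k₀

      k₁≡ : k₁ ≡ k₀ + suc d
      k₁≡ = trans (sym (m+[n∸m]≡n k₀<k₁)) (sym (+-suc k₀ d))
        where
        k₀<k₁ : k₀ < k₁
        k₀<k₁ = start-cancel-< (subst (start k₀ <_) (sym start-k₁) (m<m+n (start k₀) 1≤ℓ))

      last : ℕ
      last = k₀ + d

      start-after-last : start (suc last) ≡ start k₀ + ℓ
      start-after-last = trans (cong start (trans (sym (+-suc k₀ d)) (sym k₁≡))) start-k₁

      last<N : last < N
      last<N = start<N (≤-<-trans (<⇒≤ (start-<-suc last)) (subst (_< start N) (sym start-after-last) (early-shift<N early-k₀)))

      -- otherwise the mark of `last` would be the shift of a mark starting in [i, start k₀)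
      last-starts-in-first-half : start last < i + ℓ
      last-starts-in-first-half with start last <? i + ℓ
      ... | yes inside = inside
      ... | no outside = ⊥-elim (<⇒≱ start-k<start-k₀ (start-k₀-least k i≤start-k))
        where
        i+ℓ≤ : i + ℓ ≤ start last
        i+ℓ≤ = ≮⇒≥ outside
        fits42 : start last + 42 ≤ i + ℓ + ℓ
        fits42 = ≤-trans (+-monoˡ-≤ 42 (<⇒≤ (subst (start last <_) start-after-last (start-<-suc last))))
                   (subst (_≤ i + ℓ + ℓ) (xy∙z≈xz∙y (start k₀) 42 ℓ) (+-monoˡ-≤ ℓ early-k₀))
        unshifted : ∃ λ k → k < N × start k + ℓ ≡ start last
        unshifted = unshift-start last last<N i+ℓ≤ fits42
        k : ℕ
        k = proj₁ unshifted
        start-k+ℓ : start k + ℓ ≡ start last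
        start-k+ℓ = proj₂ (proj₂ unshifted)
        i≤start-k : i ≤ start k
        i≤start-k = +-cancelʳ-≤ ℓ i (start k) (subst (i + ℓ ≤_) (sym start-k+ℓ) i+ℓ≤)
        start-k<start-k₀ : start k < start k₀
        start-k<start-k₀ = +-cancelʳ-< ℓ (start k) (start k₀)
          (subst₂ _<_ (sym start-k+ℓ) start-after-last (start-<-suc last))

      before-last-early : ∀ j → j < d → Early (k₀ + j)
      before-last-early j j<d = subst (_≤ i + ℓ) (sym (+-suc (start (k₀ + j)) 41))
        (≤-trans (s≤s (start-gap-< (+-monoʳ-< k₀ j<d))) last-starts-in-first-half)

      len-preserved : ∀ j → Early (k₀ + j) → start (k₁ + j) ≡ start (k₀ + j) + ℓ → len (k₀ + j) ≡ len (k₁ + j)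
      len-preserved j early shifted = prefix⇒len (early⇒<N early) (start<N (subst (_< start N) (sym shifted) (early-shift<N early)))
        (trans (periodic _ 39 (i≤start-k₀+ j) (early-prefix 39 (m≤m+n 39 3) early)) (cong (λ z → window u z 39) (sym shifted)))

      shifted : ∀ j → j ≤ d → start (k₁ + j) ≡ start (k₀ + j) + ℓ
      shifted zero    _     = subst₂ (λ a b → start a ≡ start b + ℓ) (sym (+-identityʳ k₁)) (sym (+-identityʳ k₀)) start-k₁
      shifted (suc j) 1+j≤d = begin
        start (k₁ + suc j)                     ≡⟨ cong start (+-suc k₁ j) ⟩
        start (suc (k₁ + j))                   ≡⟨ start-suc (k₁ + j) ⟩
        start (k₁ + j) + len (k₁ + j)          ≡⟨ cong₂ _+_ shifted-j (sym (len-preserved j (before-last-early j 1+j≤d) shifted-j)) ⟩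
        start (k₀ + j) + ℓ + len (k₀ + j)      ≡⟨ xy∙z≈xz∙y (start (k₀ + j)) ℓ (len (k₀ + j)) ⟩
        start (k₀ + j) + len (k₀ + j) + ℓ      ≡⟨ cong (_+ ℓ) (sym (start-suc (k₀ + j))) ⟩
        start (suc (k₀ + j)) + ℓ               ≡⟨ cong (λ z → start z + ℓ) (+-suc k₀ j) ⟨
        start (k₀ + suc j) + ℓ                 ∎
        where
        open ≡-Reasoning
        shifted-j : start (k₁ + j) ≡ start (k₀ + j) + ℓ
        shifted-j = shifted j (<⇒≤ 1+j≤d)

      shifted<N : ∀ j → j ≤ d → k₁ + j < N
      shifted<N j j≤d = start<N (subst (_< start N) (sym (shifted j j≤d))
        (<-≤-trans (+-monoˡ-< ℓ (≤-<-trans (start-mono-≤ (+-monoʳ-≤ k₀ j≤d)) last-starts-in-first-half)) fits))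

      class-preserved : ∀ j → j ≤ d → start (k₀ + j) + 21 ≤ i + ℓ → class (k₀ + j) ≡ class (k₁ + j)
      class-preserved j j≤d prefix-inside = prefix⇒class (≤-<-trans (+-monoʳ-≤ k₀ j≤d) last<N) (shifted<N j j≤d)
        (trans (periodic _ 21 (i≤start-k₀+ j) prefix-inside) (cong (λ z → window u z 21) (sym (shifted j j≤d))))

      early-class-preserved : ∀ j → j < d → class (k₀ + j) ≡ class (k₁ + j)
      early-class-preserved j j<d = class-preserved j (<⇒≤ j<d) (early-prefix 21 (m≤m+n 21 21) (before-last-early j j<d))

      square-from-k₀ : start last + 21 ≤ i + ℓ → ClassSquare
      square-from-k₀ last-prefix-inside = k₀ , suc d , s≤s z≤n , fits-N , λ j j<1+d →
        subst (λ k → class (k₀ + j) ≡ class (k + j)) k₁≡ (class-preserved j (≤-pred j<1+d) (prefix-inside j (≤-pred j<1+d)))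
        where
        fits-N : k₀ + (suc d + suc d) ≤ N
        fits-N = subst (_≤ N) (trans (cong (λ k → suc (k + d)) k₁≡) (rearrange k₀ d)) (shifted<N d ≤-refl)
          where
          rearrange : ∀ a b → suc (a + suc b + b) ≡ a + (suc b + suc b)
          rearrange = solve-∀
        prefix-inside : ∀ j → j ≤ d → start (k₀ + j) + 21 ≤ i + ℓ
        prefix-inside j j≤d with m≤n⇒m<n∨m≡n j≤d
        ... | inj₁ j<d  = early-prefix 21 (m≤m+n 21 21) (before-last-early j j<d)
        ... | inj₂ refl = last-prefix-inside

      -- The 21-suffix of the block before k₀ lies in the first half, and its shift is the 21-suffix of `last`.
      square-from-block-before-k₀ : i + ℓ < start last + 21 → ClassSquare
      square-from-block-before-k₀ last-prefix-outside = k₋ , suc d , s≤s z≤n , fits-N , periodic-class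
        where
        i+21≤start-k₀ : i + 21 ≤ start k₀
        i+21≤start-k₀ = +-cancelʳ-≤ ℓ (i + 21) (start k₀)
          (subst₂ _≤_ (trans (sym (+-suc (i + ℓ) 20)) (xy∙z≈xz∙y i ℓ 21)) start-after-last
            (≤-trans (subst (suc (i + ℓ) + 20 ≤_) (+-assoc (start last) 21 20) (+-monoˡ-≤ 20 last-prefix-outside)) (start-gap last)))
        21≤start-k₀ : 21 ≤ start k₀
        21≤start-k₀ = ≤-trans (m≤n+m 21 i) i+21≤start-k₀
        k₋ : ℕ
        k₋ = k₀ ∸ 1
        k₀≡ : k₀ ≡ suc k₋
        k₀≡ = sym (m+[n∸m]≡n (start-cancel-< (subst (_< start k₀) (sym start-zero) (<-≤-trans z<s 21≤start-k₀))))
        k₋<N : k₋ < N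
        k₋<N = <-trans (subst (k₋ <_) (sym k₀≡) (n<1+n k₋)) (≤-<-trans (m≤m+n k₀ d) last<N)
        t : ℕ
        t = start k₀ ∸ 21
        t+21≡ : t + 21 ≡ start k₀
        t+21≡ = m∸n+n≡m 21≤start-k₀
        class-k₋ : class k₋ ≡ class last
        class-k₋ = suffix⇒class k₋<N last<N (trans t+21≡ (cong start k₀≡))
          (trans (xy∙z≈xz∙y t ℓ 21) (trans (cong (_+ ℓ) t+21≡) (sym start-after-last)))
          (periodic t 21 (+-cancelʳ-≤ 21 i t (subst (i + 21 ≤_) (sym t+21≡) i+21≤start-k₀))
                         (subst (_≤ i + ℓ) (sym t+21≡) (≤-trans (m≤m+n (start k₀) 42) early-k₀)))
        fits-N : k₋ + (suc d + suc d) ≤ N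
        fits-N = <⇒≤ (subst (_< N) (trans (cong (_+ d) k₁≡) (trans (cong (λ k → k + suc d + d) k₀≡) (rearrange k₋ d))) (shifted<N d ≤-refl))
          where
          rearrange : ∀ a b → suc a + suc b + b ≡ a + (suc b + suc b)
          rearrange = solve-∀
        periodic-class : ∀ j → j < suc d → class (k₋ + j) ≡ class (k₋ + suc d + j)
        periodic-class zero    _       = begin
          class (k₋ + 0)           ≡⟨ cong class (+-identityʳ k₋) ⟩
          class k₋                 ≡⟨ class-k₋ ⟩
          class (k₀ + d)           ≡⟨ cong (λ k → class (k + d)) k₀≡ ⟩
          class (suc k₋ + d)       ≡⟨ cong class (rearrange k₋ d) ⟩
          class (k₋ + suc d + 0)   ∎
          where
          open ≡-Reasoning
          rearrange : ∀ a b → suc a + b ≡ a + suc b + 0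
          rearrange = solve-∀
        periodic-class (suc j) 1+j<1+d = begin
          class (k₋ + suc j)       ≡⟨ cong class (trans (+-suc k₋ j) (cong (_+ j) (sym k₀≡))) ⟩
          class (k₀ + j)           ≡⟨ early-class-preserved j (≤-pred 1+j<1+d) ⟩
          class (k₁ + j)           ≡⟨ cong (λ k → class (k + j)) (trans k₁≡ (cong (_+ suc d) k₀≡)) ⟩
          class (suc k₋ + suc d + j) ≡⟨ cong class (rearrange k₋ d j) ⟩
          class (k₋ + suc d + suc j) ∎
          where
          open ≡-Reasoning
          rearrange : ∀ a b c → suc a + suc b + c ≡ a + suc b + suc c
          rearrange = solve-∀

      square : ClassSquare
      square with start last + 21 ≤? i + ℓ
      ... | yes inside = square-from-k₀ inside
      ... | no outside = square-from-block-before-k₀ (≰⇒> outside)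

    ThreeBlockWindow : Set
    ThreeBlockWindow = ∃ λ K → 3 + K ≤ N × start K ≤ i × i + ℓ + ℓ ≤ start (3 + K)

    module NoEarlyMark (late-k₀ : ¬ Early k₀) where

      late : ∀ k → i ≤ start k → i + ℓ < start k + 42
      late k i≤ = <-≤-trans (≰⇒> late-k₀) (+-monoˡ-≤ 42 (start-k₀-least k i≤))

      no-mark-in-second-half : ∀ k → k < N → i + ℓ ≤ start k → start k + 42 ≤ i + ℓ + ℓ → ⊥
      no-mark-in-second-half k k<N i+ℓ≤ fits42 = <⇒≱ (late k′ i≤start-k′) early-k′
        where
        unshifted : ∃ λ k′ → k′ < N × start k′ + ℓ ≡ start k
        unshifted = unshift-start k k<N i+ℓ≤ fits42
        k′ : ℕ
        k′ = proj₁ unshifted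
        start-k′+ℓ : start k′ + ℓ ≡ start k
        start-k′+ℓ = proj₂ (proj₂ unshifted)
        i≤start-k′ : i ≤ start k′
        i≤start-k′ = +-cancelʳ-≤ ℓ i (start k′) (subst (i + ℓ ≤_) (sym start-k′+ℓ) i+ℓ≤)
        early-k′ : start k′ + 42 ≤ i + ℓ
        early-k′ = +-cancelʳ-≤ ℓ (start k′ + 42) (i + ℓ)
          (subst (_≤ i + ℓ + ℓ) (trans (cong (_+ 42) (sym start-k′+ℓ)) (xy∙z≈xz∙y (start k′) ℓ 42)) fits42)

      before-next-start : ∀ {k x} → x < start k + 42 → x ≤ start (suc k)
      before-next-start {k} x< = ≤-pred (≤-trans x< (subst (_≤ suc (start (suc k))) (sym (+-suc (start k) 41)) (s≤s (start-gap k))))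

      containing-i : ∃ λ k → k < N × start k ≤ i × i < start (suc k)
      containing-i = block-containing N i (<-≤-trans (<-≤-trans (m<m+n i 1≤ℓ) (m≤m+n (i + ℓ) ℓ)) fits)
      K : ℕ
      K = proj₁ containing-i
      start-K≤i : start K ≤ i
      start-K≤i = proj₁ (proj₂ (proj₂ containing-i))
      i<start-K+1 : i < start (suc K)
      i<start-K+1 = proj₂ (proj₂ (proj₂ containing-i))

      first-half-ends : i + ℓ ≤ start (2 + K)
      first-half-ends = before-next-start (late (suc K) (<⇒≤ i<start-K+1))

      second-half-ends : i + ℓ + ℓ ≤ start (3 + K)
      second-half-ends with 2 + K <? N
      ... | yes K+2<N = before-next-start (≰⇒> (no-mark-in-second-half (2 + K) K+2<N first-half-ends))
      ... | no K+2≮N  = ≤-trans fits (≤-trans (start-mono-≤ (≮⇒≥ K+2≮N)) (<⇒≤ (start-<-suc (2 + K))))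

      three-blocks : ThreeBlockWindow
      three-blocks with 3 + K ≤? N
      ... | yes K+3≤N = K , K+3≤N , start-K≤i , second-half-ends
      ... | no K+3≰N  = N ∸ 3 , ≤-reflexive 3+K′≡N , ≤-trans (start-mono-≤ K′≤K) start-K≤i , subst (λ n → i + ℓ + ℓ ≤ start n) (sym 3+K′≡N) fits
        where
        3+K′≡N : 3 + (N ∸ 3) ≡ N
        3+K′≡N = m+[n∸m]≡n 3≤N
        K′≤K : N ∸ 3 ≤ K
        K′≤K = +-cancelˡ-≤ 3 (N ∸ 3) K (≤-trans (≤-reflexive 3+K′≡N) (<⇒≤ (≰⇒> K+3≰N)))

    square-or-window : ClassSquare ⊎ ThreeBlockWindow
    square-or-window with start k₀ + 42 ≤? i + ℓ
    ... | yes early = inj₁ (EarlyMark.square early)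
    ... | no late   = inj₂ (NoEarlyMark.three-blocks late)

  ThreeBlockSquare : Set
  ThreeBlockSquare = ∃ λ K → 3 + K ≤ N × HasSquare (window u (start K) (start (3 + K) ∸ start K))

  square⇒classSquare⊎threeBlockSquare : HasSquare u → ClassSquare ⊎ ThreeBlockSquare
  square⇒classSquare⊎threeBlockSquare (α , y , β , y≢[] , u≡) with Square.square-or-window (length α) (length y) 1≤ℓ fits periodic
    where
    1≤ℓ : 1 ≤ length y
    1≤ℓ = ≢[]⇒1≤length y≢[]
    fits : length α + length y + length y ≤ start N
    fits = subst₂ _≤_ (sym (+-assoc (length α) _ _)) (trans (cong length (sym u≡)) length-u)
      (subst (length α + (length y + length y) ≤_) (sym (length-square α y β)) (+-monoʳ-≤ (length α) (m≤m+n _ (length β))))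
    periodic : ∀ t n → length α ≤ t → t + n ≤ length α + length y → window u t n ≡ window u (t + length y) n
    periodic t n α≤t t+n≤ = subst (λ w → window w t n ≡ window w (t + length y) n) (sym u≡) (window-square α y β t n α≤t t+n≤)
  ... | inj₁ class-square = inj₁ class-square
  ... | inj₂ (K , K+3≤N , start-K≤i , fits-K) = inj₂ (K , K+3≤N , subst (λ w → HasSquare (window w (start K) _)) (sym u≡)
          (hasSquare-window α y β (start K) _ y≢[] start-K≤i
            (subst₂ _≤_ (+-assoc (length α) _ _) (sym (m+[n∸m]≡n (start-mono-≤ (m≤n+m K 3)))) fits-K)))

-- The blocks of δ

_≟Γ_ : DecidableEquality Γ
`a ≟Γ `a = yes refl
`a ≟Γ `b = no λ ()
`a ≟Γ `c = no λ ()
`b ≟Γ `a = no λ ()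
`b ≟Γ `b = yes refl
`b ≟Γ `c = no λ ()
`c ≟Γ `a = no λ ()
`c ≟Γ `b = no λ ()
`c ≟Γ `c = yes refl

permIndex : Perm → ℕ
permIndex id  = 0
permIndex ab  = 1
permIndex ac  = 2
permIndex bc  = 3
permIndex abc = 4
permIndex acb = 5

permAt : ℕ → Perm
permAt 1 = ab
permAt 2 = ac
permAt 3 = bc
permAt 4 = abc
permAt 5 = acb
permAt _ = id

permAt-permIndex : ∀ π → permAt (permIndex π) ≡ π
permAt-permIndex id  = refl
permAt-permIndex ab  = refl
permAt-permIndex ac  = refl
permAt-permIndex bc  = refl
permAt-permIndex abc = refl
permAt-permIndex acb = refl

_≟ₚ_ : DecidableEquality Perm
π ≟ₚ σ = map′ permIndex-injective (cong permIndex) (permIndex π ≟ permIndex σ)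
  where
  permIndex-injective : permIndex π ≡ permIndex σ → π ≡ σ
  permIndex-injective e = trans (sym (permAt-permIndex π)) (trans (cong permAt e) (permAt-permIndex σ))

⟨⟩-injective : ∀ {π σ} → ⟨ π ⟩ ≡ ⟨ σ ⟩ → π ≡ σ
⟨⟩-injective refl = refl

~-injective : ∀ {π σ} → ~ π ≡ ~ σ → π ≡ σ
~-injective refl = refl

_≟V_ : DecidableEquality V
⟨ π ⟩ ≟V ⟨ σ ⟩ = map′ (cong ⟨_⟩) ⟨⟩-injective (π ≟ₚ σ)
⟨ π ⟩ ≟V (~ σ) = no λ ()
(~ π) ≟V ⟨ σ ⟩ = no λ ()
(~ π) ≟V (~ σ) = map′ (cong ~_) ~-injective (π ≟ₚ σ)

vtx-injective : ∀ {x y} → vtx x ≡ vtx y → x ≡ y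
vtx-injective refl = refl

p-injective : ∀ {x y} → p x ≡ p y → x ≡ y
p-injective refl = refl

s-injective : ∀ {x y} → s x ≡ s y → x ≡ y
s-injective refl = refl

_≟ₗ_ : DecidableEquality Letter
vtx x ≟ₗ vtx y = map′ (cong vtx) vtx-injective (x ≟V y)
p x   ≟ₗ p y   = map′ (cong p) p-injective (x ≟V y)
s x   ≟ₗ s y   = map′ (cong s) s-injective (x ≟V y)
vtx _ ≟ₗ p _   = no λ ()
vtx _ ≟ₗ s _   = no λ ()
p _   ≟ₗ vtx _ = no λ ()
p _   ≟ₗ s _   = no λ ()
s _   ≟ₗ vtx _ = no λ ()
s _   ≟ₗ p _   = no λ ()

perms : List Perm
perms = id ∷ ab ∷ ac ∷ bc ∷ abc ∷ acb ∷ []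

∈-perms : ∀ π → π ∈ perms
∈-perms id  = here refl
∈-perms ab  = there (here refl)
∈-perms ac  = there (there (here refl))
∈-perms bc  = there (there (there (here refl)))
∈-perms abc = there (there (there (there (here refl))))
∈-perms acb = there (there (there (there (there (here refl)))))

vertices : List V
vertices = map ⟨_⟩ perms ++ map ~_ perms

∈-vertices : ∀ x → x ∈ vertices
∈-vertices ⟨ π ⟩ = ∈-++⁺ˡ (∈-map⁺ ⟨_⟩ (∈-perms π))
∈-vertices (~ π) = ∈-++⁺ʳ (map ⟨_⟩ perms) (∈-map⁺ ~_ (∈-perms π))

successors : V → List V
successors ⟨ id ⟩  = ~ ab ∷ ⟨ bc ⟩ ∷ []
successors ⟨ ab ⟩  = ~ id ∷ ⟨ abc ⟩ ∷ []
successors ⟨ ac ⟩  = ~ abc ∷ ⟨ acb ⟩ ∷ []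
successors ⟨ bc ⟩  = ~ acb ∷ ⟨ id ⟩ ∷ []
successors ⟨ abc ⟩ = ~ ac ∷ ⟨ ab ⟩ ∷ []
successors ⟨ acb ⟩ = ~ bc ∷ ⟨ ac ⟩ ∷ []
successors (~ id)  = ⟨ ac ⟩ ∷ ~ bc ∷ []
successors (~ ab)  = ⟨ acb ⟩ ∷ ~ abc ∷ []
successors (~ ac)  = ⟨ id ⟩ ∷ ~ acb ∷ []
successors (~ bc)  = ⟨ abc ⟩ ∷ ~ id ∷ []
successors (~ abc) = ⟨ bc ⟩ ∷ ~ ab ∷ []
successors (~ acb) = ⟨ ab ⟩ ∷ ~ ac ∷ []

arc⇒∈successors : ∀ {x y} → Arc x y → y ∈ successors x
arc⇒∈successors a1  = here refl
arc⇒∈successors a2  = there (here refl)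
arc⇒∈successors a3  = here refl
arc⇒∈successors a4  = there (here refl)
arc⇒∈successors a5  = here refl
arc⇒∈successors a6  = there (here refl)
arc⇒∈successors a7  = here refl
arc⇒∈successors a8  = there (here refl)
arc⇒∈successors a9  = here refl
arc⇒∈successors a10 = there (here refl)
arc⇒∈successors a11 = here refl
arc⇒∈successors a12 = there (here refl)
arc⇒∈successors a13 = here refl
arc⇒∈successors a14 = there (here refl)
arc⇒∈successors a15 = here refl
arc⇒∈successors a16 = there (here refl)
arc⇒∈successors a17 = here refl
arc⇒∈successors a18 = there (here refl)
arc⇒∈successors a19 = here refl
arc⇒∈successors a20 = there (here refl)
arc⇒∈successors a21 = here refl
arc⇒∈successors a22 = there (here refl)
arc⇒∈successors a23 = here refl
arc⇒∈successors a24 = there (here refl)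

data Block : Set where
  P Q R S : V → Block

letter : Block → Letter
letter (P x) = p x
letter (Q x) = vtx x
letter (R x) = vtx x
letter (S x) = s x

-- P x and S x are the images of p_x and s_x, Q x and R x the two images of the vertex x.
word : Block → List Γ
word (P ⟨ π ⟩) = twist wP ⟨ π ⟩
word (P (~ π)) = twist wS (~ π)
word (Q x)     = twist wQ x
word (R x)     = twist wR x
word (S ⟨ π ⟩) = twist wS ⟨ π ⟩
word (S (~ π)) = twist wP (~ π)

blocksOf : V → List Block
blocksOf x = P x ∷ Q x ∷ R x ∷ S x ∷ []

blocks : List Block
blocks = concatMap blocksOf vertices

∈-blocks : ∀ b → b ∈ blocks
∈-blocks b = ∈-concatMap⁺ blocksOf (Any.map (λ { refl → ∈-blocksOf b }) (∈-vertices (vertexOf b)))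
  where
  vertexOf : Block → V
  vertexOf (P x) = x
  vertexOf (Q x) = x
  vertexOf (R x) = x
  vertexOf (S x) = x
  ∈-blocksOf : ∀ b → b ∈ blocksOf (vertexOf b)
  ∈-blocksOf (P x) = here refl
  ∈-blocksOf (Q x) = there (here refl)
  ∈-blocksOf (R x) = there (there (here refl))
  ∈-blocksOf (S x) = there (there (there (here refl)))

vertexBlocks : V → List Block
vertexBlocks x = Q x ∷ R x ∷ []

-- The blocks that may follow a block in some δ(p_x w s_y) with w a walk.
next : Block → List Block
next (P x) = vertexBlocks x
next (Q x) = concatMap vertexBlocks (successors x) ++ [ S x ]
next (R x) = concatMap vertexBlocks (successors x) ++ [ S x ]
next (S x) = []

δ₁-block : ∀ l {w} → w ∈ δ₁ l → ∃ λ b → letter b ≡ l × w ≡ word b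
δ₁-block (vtx x)   (here refl)         = Q x , refl , refl
δ₁-block (vtx x)   (there (here refl)) = R x , refl , refl
δ₁-block (p ⟨ π ⟩) (here refl)         = P ⟨ π ⟩ , refl , refl
δ₁-block (p (~ π)) (here refl)         = P (~ π) , refl , refl
δ₁-block (s ⟨ π ⟩) (here refl)         = S ⟨ π ⟩ , refl , refl
δ₁-block (s (~ π)) (here refl)         = S (~ π) , refl , refl

δ-blocks : ∀ ls {u} → u ∈ δ ls → ∃ λ bs → map letter bs ≡ ls × u ≡ concat (map word bs)
δ-blocks []       (here refl) = [] , refl , refl
δ-blocks (l ∷ ls) u∈ =
  let w , w∈ , u∈′ = find (∈-concatMap⁻ (λ w → map (w ++_) (δ ls)) {xs = δ₁ l} u∈)
      v , v∈ , u≡ = ∈-map⁻ (w ++_) u∈′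
      b , letter-b , w≡ = δ₁-block l w∈
      bs , letters , v≡ = δ-blocks ls v∈
  in b ∷ bs , cong₂ _∷_ letter-b letters , trans u≡ (cong₂ _++_ w≡ v≡)

infix 4 _⟶_
_⟶_ : Block → Block → Set
a ⟶ b = b ∈ next a

LetterStep : Letter → Letter → Set
LetterStep l l′ = ∀ {a b} → letter a ≡ l → letter b ≡ l′ → a ⟶ b

linked-blocks : ∀ bs → Linked LetterStep (map letter bs) → Linked _⟶_ bs
linked-blocks []           []           = []
linked-blocks (a ∷ [])     [-]          = [-]
linked-blocks (a ∷ b ∷ bs) (step ∷ rest) = step refl refl ∷ linked-blocks (b ∷ bs) rest

p-step : ∀ x → LetterStep (p x) (vtx x)
p-step x {P .x} {Q .x} refl refl = here refl
p-step x {P .x} {R .x} refl refl = there (here refl)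

∈-vertexBlocks-successors : ∀ {x y b} → Arc x y → letter b ≡ vtx y → b ∈ concatMap vertexBlocks (successors x)
∈-vertexBlocks-successors {b = Q _} arc refl = ∈-concatMap⁺ vertexBlocks (Any.map (λ { refl → here refl }) (arc⇒∈successors arc))
∈-vertexBlocks-successors {b = R _} arc refl = ∈-concatMap⁺ vertexBlocks (Any.map (λ { refl → there (here refl) }) (arc⇒∈successors arc))

arc-step : ∀ {x y} → Arc x y → LetterStep (vtx x) (vtx y)
arc-step arc {Q _} refl b≡ = ∈-++⁺ˡ (∈-vertexBlocks-successors arc b≡)
arc-step arc {R _} refl b≡ = ∈-++⁺ˡ (∈-vertexBlocks-successors arc b≡)

s-step : ∀ y → LetterStep (vtx y) (s y)
s-step y {Q .y} {S .y} refl refl = ∈-++⁺ʳ (concatMap vertexBlocks (successors y)) (here refl)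
s-step y {R .y} {S .y} refl refl = ∈-++⁺ʳ (concatMap vertexBlocks (successors y)) (here refl)

walk⇒letterSteps : ∀ {x} w′ {y} → IsWalk (x ∷ w′ ++ [ y ]) → Linked LetterStep (vtx x ∷ map vtx (w′ ++ [ y ]) ++ [ s y ])
walk⇒letterSteps []        (arc ∷ [-])  = arc-step arc ∷ s-step _ ∷ [-]
walk⇒letterSteps (x′ ∷ w′) (arc ∷ rest) = arc-step arc ∷ walk⇒letterSteps w′ rest

S∉vertexBlocks : ∀ {y zs} → ¬ Any (λ z → S y ∈ vertexBlocks z) zs
S∉vertexBlocks (here (here ()))
S∉vertexBlocks (here (there (here ())))
S∉vertexBlocks (there S∈) = S∉vertexBlocks S∈

⟶S⇒∈vertexBlocks : ∀ {a y} → a ⟶ S y → a ∈ vertexBlocks y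
⟶S⇒∈vertexBlocks {P x} (here ())
⟶S⇒∈vertexBlocks {P x} (there (here ()))
⟶S⇒∈vertexBlocks {Q x} a⟶ with ∈-++⁻ (concatMap vertexBlocks (successors x)) a⟶
... | inj₁ S∈ = ⊥-elim (S∉vertexBlocks (∈-concatMap⁻ vertexBlocks {xs = successors x} S∈))
... | inj₂ (here refl) = here refl
⟶S⇒∈vertexBlocks {R x} a⟶ with ∈-++⁻ (concatMap vertexBlocks (successors x)) a⟶
... | inj₁ S∈ = ⊥-elim (S∉vertexBlocks (∈-concatMap⁻ vertexBlocks {xs = successors x} S∈))
... | inj₂ (here refl) = there (here refl)

-- Checked properties of the blocks

open Decide _≟Γ_

-- The certificates are stated as `… ≡ true` and proved by refl: Agda checks these by evaluation much
-- faster than `tt : T …`. For the same reason, lemmas using them name every test and list explicitly,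
-- so that unification never needs to evaluate a check.

Γs : List Γ
Γs = `a ∷ `b ∷ `c ∷ []

_⇒ᵇ_ : Bool → Bool → Bool
a ⇒ᵇ b = not a ∨ b

mark : Block → List Γ
mark b = take 42 (word b)

suffix : ℕ → List Γ → List Γ
suffix n w = drop (length w ∸ n) w

markAbsent? : List Γ → Block → Bool
markAbsent? w b = not (isPrefix? (mark b) w)

markFreeAt? : Block → List Γ → ℕ → Bool
markFreeAt? a w o = all (markAbsent? (take 42 (drop (suc o) (word a ++ w)))) blocks

markFreeWith? : Block → List Γ → Bool
markFreeWith? a w = all (markFreeAt? a w) (upTo (length (word a) ∸ 1))

continuations : Block → List (List Γ)
continuations a = [] ∷ map word (next a)

synchronising? : Block → Bool
synchronising? a = all (markFreeWith? a) (continuations a)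

long? : Block → Bool
long? b = 41 ≤ᵇ length (word b)

prefixDeterminesLetter? suffixDeterminesLetter? prefixDeterminesLength? : Block → Block → Bool
prefixDeterminesLetter? a b = (take 21 (word a) == take 21 (word b)) ⇒ᵇ isYes (letter a ≟ₗ letter b)
suffixDeterminesLetter? a b = (suffix 21 (word a) == suffix 21 (word b)) ⇒ᵇ isYes (letter a ≟ₗ letter b)
prefixDeterminesLength? a b = (take 39 (word a) == take 39 (word b)) ⇒ᵇ isYes (length (word a) ≟ length (word b))

allPairs? : (Block → Block → Bool) → Bool
allPairs? test = all (λ a → all (test a) blocks) blocks

allPaths₃? : (Block → Block → Block → Bool) → Bool
allPaths₃? test = all (λ a → all (λ b → all (test a b) (next b)) (next a)) blocks

insertionSquare? : ℕ → List Γ → List Γ → List Γ → ℕ → Γ → Bool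
insertionSquare? r before B after o x = squareNear? r (before ++ take o B) (x ∷ drop o B ++ after)

insertionsSquare? : ℕ → List Γ → List Γ → List Γ → ℕ → Bool
insertionsSquare? r before B after n = all (λ o → all (insertionSquare? r before B after o) Γs) (upTo n)

threeBlocksSquareFree? : Block → Block → Block → Bool
threeBlocksSquareFree? a b c = squareFree? (word a ++ word b ++ word c)

middleInsertions? : Block → Block → Block → Bool
middleInsertions? a b c = insertionsSquare? 20 (word a) (word b) (word c) (length (word b))

firstInsertions? : V → Bool
firstInsertions? x = all (λ b → insertionsSquare? 25 [] (word (P x)) (word b) (length (word (P x)))) (next (P x))

lastInsertions? : V → Bool
lastInsertions? x = all (λ a → insertionsSquare? 25 (word a) (word (S x)) [] (suc (length (word (S x))))) (vertexBlocks x)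

synchronising-checked : all synchronising? blocks ≡ true
synchronising-checked = refl

long-checked : all long? blocks ≡ true
long-checked = refl

prefixDeterminesLetter-checked : allPairs? prefixDeterminesLetter? ≡ true
prefixDeterminesLetter-checked = refl

suffixDeterminesLetter-checked : allPairs? suffixDeterminesLetter? ≡ true
suffixDeterminesLetter-checked = refl

prefixDeterminesLength-checked : allPairs? prefixDeterminesLength? ≡ true
prefixDeterminesLength-checked = refl

threeBlocksSquareFree-checked : allPaths₃? threeBlocksSquareFree? ≡ true
threeBlocksSquareFree-checked = refl

middleInsertions-checked : allPaths₃? middleInsertions? ≡ true
middleInsertions-checked = refl

firstInsertions-checked : all firstInsertions? vertices ≡ true
firstInsertions-checked = refl

lastInsertions-checked : all lastInsertions? vertices ≡ true
lastInsertions-checked = refl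

T-all : ∀ {A : Set} (test : A → Bool) xs → T (all test xs) → ∀ {x} → x ∈ xs → T (test x)
T-all test xs holds = lookup (all⁺ test xs holds)

certified : ∀ {b} → b ≡ true → T b
certified = Equivalence.from T-≡

certified-all : ∀ {A : Set} (test : A → Bool) xs → all test xs ≡ true → ∀ {x} → x ∈ xs → T (test x)
certified-all test xs certificate = T-all test xs (certified certificate)

T-⇒ᵇ : ∀ {a b} → T (a ⇒ᵇ b) → T a → T b
T-⇒ᵇ {true} t _ = t

word-length≥41 : ∀ b → 41 ≤ length (word b)
word-length≥41 b = ≤ᵇ⇒≤ 41 (length (word b)) (certified-all long? blocks long-checked (∈-blocks b))

mark-only-at-start : ∀ a {w} → w ∈ continuations a → ∀ {o} → 0 < o → o < length (word a) →
                     ∀ b r → take 42 (drop o (word a ++ w)) ≢ mark b ++ r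
mark-only-at-start a {w} w∈ {suc o} _ o< b r found =
  T-not⁻ {isPrefix? (mark b) v} (T-all (markAbsent? v) blocks mark-free (∈-blocks b))
    (subst (λ z → T (isPrefix? (mark b) z)) (sym found) (isPrefix?-complete (mark b) r))
  where
  v : List Γ
  v = take 42 (drop (suc o) (word a ++ w))
  mark-free : T (markFreeAt? a w o)
  mark-free = T-all (markFreeAt? a w) (upTo (length (word a) ∸ 1))
    (T-all (markFreeWith? a) (continuations a) (certified-all synchronising? blocks synchronising-checked (∈-blocks a)) w∈)
    (∈-upTo⁺ (∸-monoˡ-≤ 1 o<))

allPairs?-sound : ∀ (test : Block → Block → Bool) → allPairs? test ≡ true → ∀ a b → T (test a b)
allPairs?-sound test certificate a b = T-all (test a) blocks (certified-all (λ a → all (test a) blocks) blocks certificate (∈-blocks a)) (∈-blocks b)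

allPaths₃?-sound : ∀ (test : Block → Block → Block → Bool) → allPaths₃? test ≡ true → ∀ {a b c} → a ⟶ b → b ⟶ c → T (test a b c)
allPaths₃?-sound test certificate {a} {b} a⟶b b⟶c = T-all (test a b) (next b)
  (T-all (λ b → all (test a b) (next b)) (next a)
    (certified-all (λ a → all (λ b → all (test a b) (next b)) (next a)) blocks certificate (∈-blocks a)) a⟶b) b⟶c

prefix⇒letter : ∀ a b → take 21 (word a) ≡ take 21 (word b) → letter a ≡ letter b
prefix⇒letter a b same = toWitness (T-⇒ᵇ (allPairs?-sound prefixDeterminesLetter? prefixDeterminesLetter-checked a b)
  (subst (λ v → T (take 21 (word a) == v)) same (==-refl (take 21 (word a)))))

suffix⇒letter : ∀ a b → suffix 21 (word a) ≡ suffix 21 (word b) → letter a ≡ letter b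
suffix⇒letter a b same = toWitness (T-⇒ᵇ (allPairs?-sound suffixDeterminesLetter? suffixDeterminesLetter-checked a b)
  (subst (λ v → T (suffix 21 (word a) == v)) same (==-refl (suffix 21 (word a)))))

prefix⇒length : ∀ a b → take 39 (word a) ≡ take 39 (word b) → length (word a) ≡ length (word b)
prefix⇒length a b same = toWitness (T-⇒ᵇ (allPairs?-sound prefixDeterminesLength? prefixDeterminesLength-checked a b)
  (subst (λ v → T (take 39 (word a) == v)) same (==-refl (take 39 (word a)))))

threeBlocks-squareFree : ∀ {a b c} → a ⟶ b → b ⟶ c → SquareFree (word a ++ word b ++ word c)
threeBlocks-squareFree {a} {b} {c} a⟶b b⟶c = squareFree?-sound (word a ++ word b ++ word c) (allPaths₃?-sound threeBlocksSquareFree? threeBlocksSquareFree-checked {a} {b} {c} a⟶b b⟶c)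

∈-Γs : ∀ x → x ∈ Γs
∈-Γs `a = here refl
∈-Γs `b = there (here refl)
∈-Γs `c = there (there (here refl))

insertionsSquare?-sound : ∀ r before B after n → T (insertionsSquare? r before B after n) →
                          ∀ {o} → o < n → ∀ x → HasSquare ((before ++ take o B) ++ x ∷ drop o B ++ after)
insertionsSquare?-sound r before B after n holds {o} o<n x = squareNear?-sound r (before ++ take o B) (x ∷ drop o B ++ after)
  (T-all (insertionSquare? r before B after o) Γs (T-all (λ o → all (insertionSquare? r before B after o) Γs) (upTo n) holds (∈-upTo⁺ o<n)) (∈-Γs x))

middle-insertion : ∀ {a b c} → a ⟶ b → b ⟶ c → ∀ {o} → o < length (word b) → ∀ x →
                   HasSquare ((word a ++ take o (word b)) ++ x ∷ drop o (word b) ++ word c)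
middle-insertion {a} {b} {c} a⟶b b⟶c = insertionsSquare?-sound 20 (word a) (word b) (word c) (length (word b))
  (allPaths₃?-sound middleInsertions? middleInsertions-checked {a} {b} {c} a⟶b b⟶c)

first-insertion : ∀ {v b} → P v ⟶ b → ∀ {o} → o < length (word (P v)) → ∀ x →
                  HasSquare (take o (word (P v)) ++ x ∷ drop o (word (P v)) ++ word b)
first-insertion {v} {b} P⟶b = insertionsSquare?-sound 25 [] (word (P v)) (word b) (length (word (P v)))
  (T-all (λ b → insertionsSquare? 25 [] (word (P v)) (word b) (length (word (P v)))) (next (P v))
    (certified-all firstInsertions? vertices firstInsertions-checked (∈-vertices v)) P⟶b)

last-insertion : ∀ {v a} → a ∈ vertexBlocks v → ∀ {o} → o ≤ length (word (S v)) → ∀ x →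
                 HasSquare ((word a ++ take o (word (S v))) ++ x ∷ drop o (word (S v)) ++ [])
last-insertion {v} {a} a∈ o≤ = insertionsSquare?-sound 25 (word a) (word (S v)) [] (suc (length (word (S v))))
  (T-all (λ a → insertionsSquare? 25 (word a) (word (S v)) [] (suc (length (word (S v))))) (vertexBlocks v)
    (certified-all lastInsertions? vertices lastInsertions-checked (∈-vertices v)) a∈) (s≤s o≤)

mark-nonempty : ∀ b r → [] ≢ mark b ++ r
mark-nonempty b r with word b | word-length≥41 b
... | _ ∷ _ | _ = λ ()

-- Concatenations of blocks

module Concatenation (bs : List Block) (3≤N : 3 ≤ length bs) (linked : Linked _⟶_ bs) where

  N : ℕ
  N = length bs

  -- S ⟨ id ⟩ is a dummy value for indices beyond the last block.
  at : ℕ → Block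
  at = lookupOr (S ⟨ id ⟩) bs

  ws : List (List Γ)
  ws = map word bs

  u : List Γ
  u = concat ws

  start : ℕ → ℕ
  start = wordStart (word (S ⟨ id ⟩)) ws

  len : ℕ → ℕ
  len k = length (lookupOr (word (S ⟨ id ⟩)) ws k)

  word-at : ∀ k → lookupOr (word (S ⟨ id ⟩)) ws k ≡ word (at k)
  word-at = lookupOr-map word (S ⟨ id ⟩) bs

  len≡ : ∀ k → len k ≡ length (word (at k))
  len≡ k = cong length (word-at k)

  len≥41 : ∀ k → 41 ≤ len k
  len≥41 k = subst (41 ≤_) (sym (len≡ k)) (word-length≥41 (at k))

  open StartPositions start len refl (λ _ → refl) len≥41

  length-u : length u ≡ start N
  length-u = trans (length-concat _ ws) (cong start (length-map word bs))

  u-ends : drop (start N) u ≡ []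
  u-ends = drop-all (start N) u (≤-reflexive length-u)

  block-at : ∀ {k} → k < N → drop (start k) u ≡ word (at k) ++ drop (start (suc k)) u
  block-at {k} k<N = trans (drop-wordStart-lookupOr _ ws k (subst (k <_) (sym (length-map word bs)) k<N)) (cong (_++ drop (start (suc k)) u) (word-at k))

  step-at : ∀ {k} → suc k < N → at k ⟶ at (suc k)
  step-at = linked-lookupOr (S ⟨ id ⟩) linked

  window-at-start : ∀ {k} n → k < N → n ≤ 41 → window u (start k) n ≡ take n (word (at k))
  window-at-start {k} n k<N n≤41 = trans (cong (take n) (block-at k<N)) (take-++ˡ n (word (at k)) _ (≤-trans n≤41 (word-length≥41 (at k))))

  window-at-end : ∀ {k t} → k < N → t + 21 ≡ start (suc k) → window u t 21 ≡ suffix 21 (word (at k))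
  window-at-end {k} {t} k<N t+21≡ = begin
    take 21 (drop t u)                                  ≡⟨ cong (λ n → take 21 (drop n u)) t≡ ⟩
    take 21 (drop (start k + (len k ∸ 21)) u)           ≡⟨ cong (take 21) (drop-drop (start k) (len k ∸ 21) u) ⟨
    take 21 (drop (len k ∸ 21) (drop (start k) u))      ≡⟨ cong (λ v → take 21 (drop (len k ∸ 21) v)) (block-at k<N) ⟩
    take 21 (drop (len k ∸ 21) (word (at k) ++ rest))   ≡⟨ cong (take 21) (drop-++ˡ (len k ∸ 21) (word (at k)) rest (≤-trans (m∸n≤m (len k) 21) (≤-reflexive (len≡ k)))) ⟩
    take 21 (suffix′ ++ rest)                           ≡⟨ take-++ˡ 21 suffix′ rest (≤-reflexive (sym |suffix′|)) ⟩
    take 21 suffix′                                     ≡⟨ take-all 21 suffix′ (≤-reflexive |suffix′|) ⟩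
    suffix′                                             ≡⟨ cong (λ n → drop (n ∸ 21) (word (at k))) (len≡ k) ⟩
    suffix 21 (word (at k))                             ∎
    where
    open ≡-Reasoning
    rest suffix′ : List Γ
    rest = drop (start (suc k)) u
    suffix′ = drop (len k ∸ 21) (word (at k))
    21≤len : 21 ≤ len k
    21≤len = ≤-trans (m≤m+n 21 20) (len≥41 k)
    t≡ : t ≡ start k + (len k ∸ 21)
    t≡ = +-cancelʳ-≡ 21 t _ (trans t+21≡ (trans (cong (start k +_) (sym (m∸n+n≡m 21≤len))) (sym (+-assoc (start k) _ 21))))
    |suffix′| : length suffix′ ≡ 21
    |suffix′| = trans (length-drop (len k ∸ 21) (word (at k))) (trans (cong (_∸ (len k ∸ 21)) (sym (len≡ k))) (m∸[m∸n]≡n 21≤len))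

  IsMark : List Γ → Set
  IsMark w = ∃ λ b → ∃ λ r → w ≡ mark b ++ r

  mark-at-start : ∀ k → k < N → IsMark (window u (start k) 42)
  mark-at-start k k<N = at k , take (42 ∸ length (word (at k))) rest ,
    trans (cong (take 42) (block-at k<N)) (take-++ 42 (word (at k)) rest)
    where
    rest : List Γ
    rest = drop (start (suc k)) u

  window-inside-block : ∀ {k o} → k < N → o < length (word (at k)) →
                        ∃ λ w → w ∈ continuations (at k) × window u (start k + o) 42 ≡ take 42 (drop o (word (at k) ++ w))
  window-inside-block {k} {o} k<N o< with suc k <? N
  ... | yes k+1<N = word (at (suc k)) , there (∈-map⁺ word (step-at k+1<N)) , (begin
    take 42 (drop (start k + o) u)                                  ≡⟨ cong (take 42) (drop-drop (start k) o u) ⟨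
    take 42 (drop o (drop (start k) u))                             ≡⟨ cong (λ v → take 42 (drop o v)) (trans (block-at k<N) (cong (word (at k) ++_) (block-at k+1<N))) ⟩
    take 42 (drop o (word (at k) ++ word (at (suc k)) ++ rest))     ≡⟨ cong (λ v → take 42 (drop o v)) (++-assoc (word (at k)) _ rest) ⟨
    take 42 (drop o ((word (at k) ++ word (at (suc k))) ++ rest))   ≡⟨ cong (take 42) (drop-++ˡ o _ rest o≤) ⟩
    take 42 (drop o (word (at k) ++ word (at (suc k))) ++ rest)     ≡⟨ take-++ˡ 42 _ rest 42≤ ⟩
    take 42 (drop o (word (at k) ++ word (at (suc k))))             ∎)
    where
    open ≡-Reasoning
    rest : List Γ
    rest = drop (start (suc (suc k))) u
    |ab| : length (word (at k) ++ word (at (suc k))) ≡ length (word (at k)) + length (word (at (suc k)))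
    |ab| = length-++ (word (at k))
    o≤ : o ≤ length (word (at k) ++ word (at (suc k)))
    o≤ = subst (o ≤_) (sym |ab|) (≤-trans (<⇒≤ o<) (m≤m+n _ _))
    42≤ : 42 ≤ length (drop o (word (at k) ++ word (at (suc k))))
    42≤ = subst (42 ≤_) (sym (trans (length-drop o _) (cong (_∸ o) |ab|)))
            (m+n≤o⇒m≤o∸n 42 (subst (_≤ length (word (at k)) + length (word (at (suc k)))) (trans (sym (+-suc o 41)) (+-comm o 42)) (+-mono-≤ o< (word-length≥41 (at (suc k))))))
  ... | no k+1≮N = [] , here refl , (begin
    take 42 (drop (start k + o) u)                    ≡⟨ cong (take 42) (drop-drop (start k) o u) ⟨
    take 42 (drop o (drop (start k) u))               ≡⟨ cong (λ v → take 42 (drop o v)) (block-at k<N) ⟩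
    take 42 (drop o (word (at k) ++ drop (start (suc k)) u)) ≡⟨ cong (λ n → take 42 (drop o (word (at k) ++ drop (start n) u))) (≤-antisym k<N (≮⇒≥ k+1≮N)) ⟩
    take 42 (drop o (word (at k) ++ drop (start N) u)) ≡⟨ cong (λ v → take 42 (drop o (word (at k) ++ v))) u-ends ⟩
    take 42 (drop o (word (at k) ++ []))               ∎)
    where open ≡-Reasoning

  mark⇒start : ∀ t → IsMark (window u t 42) → ∃ λ k → k < N × start k ≡ t
  mark⇒start t (b , r , found) = k , k<N , trans (sym (+-identityʳ (start k))) (trans (cong (start k +_) (sym offset≡0)) t≡)
    where
    t<start-N : t < start N
    t<start-N with t <? start N
    ... | yes t< = t<
    ... | no t≮  = ⊥-elim (mark-nonempty b r (trans (sym (cong (take 42) (drop-all t u (≤-trans (≤-reflexive length-u) (≮⇒≥ t≮))))) found))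
    containing : ∃ λ k → k < N × start k ≤ t × t < start (suc k)
    containing = block-containing N t t<start-N
    k : ℕ
    k = proj₁ containing
    k<N : k < N
    k<N = proj₁ (proj₂ containing)
    o : ℕ
    o = t ∸ start k
    t≡ : start k + o ≡ t
    t≡ = m+[n∸m]≡n (proj₁ (proj₂ (proj₂ containing)))
    o< : o < length (word (at k))
    o< = +-cancelˡ-< (start k) o _ (subst₂ _<_ (sym t≡) (cong (start k +_) (len≡ k)) (proj₂ (proj₂ (proj₂ containing))))
    inside : ∃ λ w → w ∈ continuations (at k) × window u (start k + o) 42 ≡ take 42 (drop o (word (at k) ++ w))
    inside = window-inside-block k<N o<
    offset≡0 : o ≡ 0
    offset≡0 with o ≟ 0
    ... | yes o≡0 = o≡0
    ... | no o≢0  = ⊥-elim (mark-only-at-start (at k) (proj₁ (proj₂ inside)) (n≢0⇒n>0 o≢0) o< b r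
                      (trans (sym (proj₂ (proj₂ inside))) (trans (cong (λ n → window u n 42) t≡) found)))

  prefix⇒class : ∀ {k k′} → k < N → k′ < N → window u (start k) 21 ≡ window u (start k′) 21 → letter (at k) ≡ letter (at k′)
  prefix⇒class {k} {k′} k<N k′<N same = prefix⇒letter (at k) (at k′)
    (trans (sym (window-at-start 21 k<N (m≤m+n 21 20))) (trans same (window-at-start 21 k′<N (m≤m+n 21 20))))

  suffix⇒class : ∀ {k k′ t t′} → k < N → k′ < N → t + 21 ≡ start (suc k) → t′ + 21 ≡ start (suc k′) →
                 window u t 21 ≡ window u t′ 21 → letter (at k) ≡ letter (at k′)
  suffix⇒class {k} {k′} k<N k′<N t+21≡ t′+21≡ same = suffix⇒letter (at k) (at k′)
    (trans (sym (window-at-end k<N t+21≡)) (trans same (window-at-end k′<N t′+21≡)))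

  prefix⇒len : ∀ {k k′} → k < N → k′ < N → window u (start k) 39 ≡ window u (start k′) 39 → len k ≡ len k′
  prefix⇒len {k} {k′} k<N k′<N same = trans (len≡ k) (trans (prefix⇒length (at k) (at k′)
    (trans (sym (window-at-start 39 k<N (m≤m+n 39 2))) (trans same (window-at-start 39 k′<N (m≤m+n 39 2))))) (sym (len≡ k′)))

  open Synchronisation u N 3≤N start len refl (λ _ → refl) len≥41 length-u IsMark mark-at-start mark⇒start
                       (λ k → letter (at k)) prefix⇒class suffix⇒class prefix⇒len

  three-blocks : ∀ K → 3 + K ≤ N → window u (start K) (start (3 + K) ∸ start K) ≡ word (at K) ++ word (at (1 + K)) ++ word (at (2 + K))
  three-blocks K K+3≤N = begin
    take (start (3 + K) ∸ start K) (drop (start K) u)  ≡⟨ cong₂ take length-W drop-K ⟩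
    take (length W) (W ++ rest)                       ≡⟨ take-length W rest ⟩
    W                                                 ∎
    where
    open ≡-Reasoning
    W rest : List Γ
    W = word (at K) ++ word (at (1 + K)) ++ word (at (2 + K))
    rest = drop (start (3 + K)) u
    K+2<N : 2 + K < N
    K+2<N = K+3≤N
    K+1<N : 1 + K < N
    K+1<N = <-trans (n<1+n (1 + K)) K+2<N
    drop-K : drop (start K) u ≡ W ++ rest
    drop-K = trans (block-at (<-trans (n<1+n K) K+1<N)) (trans (cong (word (at K) ++_) (trans (block-at K+1<N)
               (cong (word (at (1 + K)) ++_) (block-at K+2<N)))) (sym (++-assoc₃ (word (at K)) (word (at (1 + K))) (word (at (2 + K))) rest)))
    length-W : start (3 + K) ∸ start K ≡ length W
    length-W = begin
      start K + len K + len (1 + K) + len (2 + K) ∸ start K     ≡⟨ cong (_∸ start K) (trans (+-assoc (start K + len K) (len (1 + K)) (len (2 + K))) (+-assoc (start K) (len K) (len (1 + K) + len (2 + K)))) ⟩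
      start K + (len K + (len (1 + K) + len (2 + K))) ∸ start K ≡⟨ m+n∸m≡n (start K) _ ⟩
      len K + (len (1 + K) + len (2 + K))                       ≡⟨ cong₂ _+_ (len≡ K) (cong₂ _+_ (len≡ (1 + K)) (len≡ (2 + K))) ⟩
      length (word (at K)) + (length (word (at (1 + K))) + length (word (at (2 + K))))
        ≡⟨ trans (cong (length (word (at K)) +_) (sym (length-++ (word (at (1 + K)))))) (sym (length-++ (word (at K)))) ⟩
      length W                                                  ∎

  classSquare⇒letterSquare : ClassSquare → HasSquare (map letter bs)
  classSquare⇒letterSquare (k , d , 1≤d , fits , same) = periodic⇒hasSquare (letter (S ⟨ id ⟩)) (map letter bs) k d 1≤d
    (subst (k + (d + d) ≤_) (sym (length-map letter bs)) fits)
    (λ j j<d → trans (lookupOr-map letter (S ⟨ id ⟩) bs (k + j)) (trans (same j j<d) (sym (lookupOr-map letter (S ⟨ id ⟩) bs (k + d + j)))))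

  no-threeBlockSquare : ¬ ThreeBlockSquare
  no-threeBlockSquare (K , K+3≤N , square₃) = threeBlocks-squareFree {at K} {at (1 + K)} {at (2 + K)}
    (step-at {K} (≤-trans (n≤1+n (2 + K)) K+3≤N)) (step-at {1 + K} K+3≤N) (subst HasSquare (three-blocks K K+3≤N) square₃)

  squareFree : SquareFree (map letter bs) → SquareFree u
  squareFree letters-squareFree square =
    [ letters-squareFree ∘ classSquare⇒letterSquare , no-threeBlockSquare ]′ (square⇒classSquare⊎threeBlockSquare square)

  module Insertions {x₀ y₀ : V} (first : at 0 ≡ P x₀) (last : at (N ∸ 1) ≡ S y₀) where

    M : ℕ
    M = N ∸ 1

    1+M≡N : suc M ≡ N
    1+M≡N = m+[n∸m]≡n (≤-trans (s≤s z≤n) 3≤N)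

    insertion-at : ∀ j → j ≤ N → ∀ {L B C rest} → drop (start j) u ≡ L ++ B ++ C ++ rest →
                   ∀ {t} o → start j + length L + o ≡ t → o ≤ length B → ∀ x →
                   HasSquare ((L ++ take o B) ++ x ∷ drop o B ++ C) → HasSquare (take t u ++ x ∷ drop t u)
    insertion-at j j≤N {L} {B} {C} {rest} drop≡ o refl o≤ x square =
      subst (λ v → HasSquare (take (start j + length L + o) v ++ x ∷ drop (start j + length L + o) v)) (sym u≡)
        (subst (λ n → HasSquare (take (n + length L + o) w ++ x ∷ drop (n + length L + o) w)) |pre|
          (hasSquare-insertion pre L B C rest o x o≤ square))
      where
      pre w : List Γ
      pre = take (start j) u
      w = pre ++ L ++ B ++ C ++ rest
      |pre| : length pre ≡ start j
      |pre| = trans (length-take (start j) u) (m≤n⇒m⊓n≡m (subst (start j ≤_) (sym length-u) (start-mono-≤ j≤N)))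
      u≡ : u ≡ w
      u≡ = trans (sym (take++drop≡id (start j) u)) (cong (pre ++_) drop≡)

    insertion-in-first : ∀ {t} → t < start 1 → ∀ x → HasSquare (take t u ++ x ∷ drop t u)
    insertion-in-first {t} t< x = insertion-at 0 z≤n {[]} {word (at 0)} {word (at 1)} drop≡ t refl (<⇒≤ t<|B|) x
      (subst (λ b → HasSquare (take t (word b) ++ x ∷ drop t (word b) ++ word (at 1))) (sym first)
        (first-insertion {x₀} {at 1} (subst (_⟶ at 1) first (step-at {0} 1<N)) (subst (λ b → t < length (word b)) first t<|B|) x))
      where
      1<N : 1 < N
      1<N = ≤-trans (s≤s (s≤s z≤n)) 3≤N
      t<|B| : t < length (word (at 0))
      t<|B| = subst (t <_) (len≡ 0) t<
      drop≡ : drop (start 0) u ≡ [] ++ word (at 0) ++ word (at 1) ++ drop (start 2) u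
      drop≡ = trans (block-at (<-trans z<s 1<N)) (cong (word (at 0) ++_) (block-at 1<N))

    insertion-in-middle : ∀ {t} → start 1 ≤ t → t < start M → ∀ x → HasSquare (take t u ++ x ∷ drop t u)
    insertion-in-middle {t} start-1≤t t<start-M x = insertion-at j (<⇒≤ j<N) {word (at j)} {word (at k)} {word (at (suc k))} drop≡ o t≡ (<⇒≤ o<) x
      (middle-insertion {at j} {at k} {at (suc k)} step₁ step₂ o< x)
      where
      containing : ∃ λ k → k < N × start k ≤ t × t < start (suc k)
      containing = block-containing N t (<-≤-trans t<start-M (start-mono-≤ (m∸n≤m N 1)))
      k : ℕ
      k = proj₁ containing
      start-k≤t : start k ≤ t
      start-k≤t = proj₁ (proj₂ (proj₂ containing))
      t<start-k+1 : t < start (suc k)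
      t<start-k+1 = proj₂ (proj₂ (proj₂ containing))
      k<M : k < M
      k<M = start-cancel-< (≤-<-trans start-k≤t t<start-M)
      k+1<N : suc k < N
      k+1<N = subst (suc k <_) 1+M≡N (s≤s k<M)
      j : ℕ
      j = k ∸ 1
      1+j≡k : suc j ≡ k
      1+j≡k = m+[n∸m]≡n (≤-pred (start-cancel-< (≤-<-trans start-1≤t t<start-k+1)))
      k<N : k < N
      k<N = <-trans (n<1+n k) k+1<N
      j<N : j < N
      j<N = <-trans (subst (j <_) 1+j≡k (n<1+n j)) k<N
      drop≡ : drop (start j) u ≡ word (at j) ++ word (at k) ++ word (at (suc k)) ++ drop (start (2 + k)) u
      drop≡ = trans (block-at j<N) (cong (word (at j) ++_) (trans (cong (λ m → drop (start m) u) 1+j≡k)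
                (trans (block-at k<N) (cong (word (at k) ++_) (block-at k+1<N)))))
      o : ℕ
      o = t ∸ start k
      o< : o < length (word (at k))
      o< = +-cancelˡ-< (start k) o _ (subst₂ _<_ (sym (m+[n∸m]≡n start-k≤t)) (cong (start k +_) (len≡ k)) t<start-k+1)
      t≡ : start j + length (word (at j)) + o ≡ t
      t≡ = trans (cong (λ n → start j + n + o) (sym (len≡ j))) (trans (cong (λ m → start m + o) 1+j≡k) (m+[n∸m]≡n start-k≤t))
      step₁ : at j ⟶ at k
      step₁ = subst (λ m → at j ⟶ at m) 1+j≡k (step-at (subst (_< N) (sym 1+j≡k) k<N))
      step₂ : at k ⟶ at (suc k)
      step₂ = step-at k+1<N

    insertion-in-last : ∀ {t} → start M ≤ t → t ≤ start N → ∀ x → HasSquare (take t u ++ x ∷ drop t u)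
    insertion-in-last {t} start-M≤t t≤start-N x = insertion-at j (<⇒≤ j<N) {word (at j)} {word (at M)} {[]} drop≡ o t≡ o≤ x
      (subst (λ b → HasSquare ((word (at j) ++ take o (word b)) ++ x ∷ drop o (word b) ++ [])) (sym last)
        (last-insertion {y₀} {at j} (⟶S⇒∈vertexBlocks {at j} {y₀} step) (subst (λ b → o ≤ length (word b)) last o≤) x))
      where
      M<N : M < N
      M<N = subst (M <_) 1+M≡N (n<1+n M)
      j : ℕ
      j = M ∸ 1
      1+j≡M : suc j ≡ M
      1+j≡M = m+[n∸m]≡n (≤-trans (s≤s z≤n) (≤-pred (subst (3 ≤_) (sym 1+M≡N) 3≤N)))
      j<N : j < N
      j<N = <-trans (subst (j <_) 1+j≡M (n<1+n j)) M<N
      drop≡ : drop (start j) u ≡ word (at j) ++ word (at M) ++ [] ++ []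
      drop≡ = trans (block-at j<N) (cong (word (at j) ++_) (trans (cong (λ m → drop (start m) u) 1+j≡M)
                (trans (block-at M<N) (cong (word (at M) ++_) (trans (cong (λ m → drop (start m) u) 1+M≡N) u-ends)))))
      o : ℕ
      o = t ∸ start M
      o≤ : o ≤ length (word (at M))
      o≤ = +-cancelˡ-≤ (start M) o _ (subst₂ _≤_ (sym (m+[n∸m]≡n start-M≤t)) (trans (cong start (sym 1+M≡N)) (cong (start M +_) (len≡ M))) t≤start-N)
      t≡ : start j + length (word (at j)) + o ≡ t
      t≡ = trans (cong (λ n → start j + n + o) (sym (len≡ j))) (trans (cong (λ m → start m + o) 1+j≡M) (m+[n∸m]≡n start-M≤t))
      step : at j ⟶ S y₀
      step = subst (at j ⟶_) last (subst (λ m → at j ⟶ at m) 1+j≡M (step-at (subst (_< N) (sym 1+j≡M) M<N)))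

    insertion-square : ∀ u′ u″ x → u′ ++ u″ ≡ u → HasSquare (u′ ++ x ∷ u″)
    insertion-square u′ u″ x u′++u″≡u = subst₂ (λ v v′ → HasSquare (v ++ x ∷ v′)) take≡ drop≡ (by-position (length u′) t≤)
      where
      take≡ : take (length u′) u ≡ u′
      take≡ = trans (cong (take (length u′)) (sym u′++u″≡u)) (take-length u′ u″)
      drop≡ : drop (length u′) u ≡ u″
      drop≡ = trans (cong (drop (length u′)) (sym u′++u″≡u)) (drop-length u′ u″)
      t≤ : length u′ ≤ start N
      t≤ = subst (length u′ ≤_) (trans (trans (sym (length-++ u′)) (cong length u′++u″≡u)) length-u) (m≤m+n (length u′) (length u″))
      by-position : ∀ t → t ≤ start N → HasSquare (take t u ++ x ∷ drop t u)
      by-position t t≤ with t <? start 1 | t <? start M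
      ... | yes t<1 | _       = insertion-in-first t<1 x
      ... | no t≮1  | yes t<M = insertion-in-middle (≮⇒≥ t≮1) t<M x
      ... | no _    | no t≮M  = insertion-in-last (≮⇒≥ t≮M) t≤ x

    extremal : SquareFree (map letter bs) → ExtremalSquareFree u
    extremal letters-squareFree =
      squareFree letters-squareFree , λ u′ u″ x u′++u″≡u extension-squareFree → extension-squareFree (insertion-square u′ u″ x u′++u″≡u)

unlabel : Letter → V
unlabel (vtx x) = x
unlabel (p x)   = x
unlabel (s x)   = x

letterWord-squareFree : ∀ x y W → SquareFree W → SquareFree (p x ∷ map vtx W ++ [ s y ])
letterWord-squareFree x y W W-squareFree square =
  W-squareFree (hasSquare-map⁻ unlabel (λ _ → refl) (hasSquare-∷ʳ⁻ s∉ (hasSquare-∷⁻ p∉ square)))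
  where
  p∉ : p x ∈ map vtx W ++ [ s y ] → ⊥
  p∉ p∈ with ∈-++⁻ (map vtx W) p∈
  ... | inj₁ p∈W with ∈-map⁻ vtx p∈W
  ...   | _ , _ , ()
  p∉ p∈ | inj₂ (here ())
  s∉ : s y ∈ map vtx W → ⊥
  s∉ s∈ with ∈-map⁻ vtx s∈
  ... | _ , _ , ()

letter≡p⇒P : ∀ {b x} → letter b ≡ p x → b ≡ P x
letter≡p⇒P {P _} refl = refl

letter≡s⇒S : ∀ {b y} → letter b ≡ s y → b ≡ S y
letter≡s⇒S {S _} refl = refl

length-blocks : ∀ {bs ls} → map letter bs ≡ ls → length bs ≡ length ls
length-blocks {bs} letters = trans (sym (length-map letter bs)) (cong length letters)

first-block : ∀ {bs x ls} → map letter bs ≡ p x ∷ ls → lookupOr (S ⟨ id ⟩) bs 0 ≡ P x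
first-block {_ ∷ _} letters = letter≡p⇒P (∷-injectiveˡ letters)

last-block : ∀ {bs y} ls → map letter bs ≡ ls ++ [ s y ] → lookupOr (S ⟨ id ⟩) bs (length bs ∸ 1) ≡ S y
last-block {bs} {y} ls letters = letter≡s⇒S (begin
  letter (lookupOr (S ⟨ id ⟩) bs (length bs ∸ 1))       ≡⟨ lookupOr-map letter (S ⟨ id ⟩) bs (length bs ∸ 1) ⟨
  lookupOr (s ⟨ id ⟩) (map letter bs) (length bs ∸ 1)  ≡⟨ cong₂ (lookupOr (s ⟨ id ⟩)) letters last-index ⟩
  lookupOr (s ⟨ id ⟩) (ls ++ [ s y ]) (length ls)       ≡⟨ lookupOr-last (s ⟨ id ⟩) ls (s y) ⟩
  s y                                                    ∎)
  where
  open ≡-Reasoning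
  last-index : length bs ∸ 1 ≡ length ls
  last-index = trans (cong (_∸ 1) (trans (length-blocks letters) (length-++ ls))) (m+n∸n≡m (length ls) 1)

corollary9 : (x y : V) (w' : List V) →
    IsWalk (x ∷ w' ++ y ∷ []) →
    SquareFree (x ∷ w' ++ y ∷ []) →
    (u : List Γ) → u ∈ δ (p x ∷ map vtx (x ∷ w' ++ y ∷ []) ++ s y ∷ []) →
    ExtremalSquareFree u
corollary9 x y w′ walk walk-squareFree u u∈ with δ-blocks _ u∈
... | bs , letters , refl = Concatenation.Insertions.extremal bs
  (subst (3 ≤_) (sym (length-blocks letters)) (s≤s (s≤s (length-++-≤ʳ [ s y ] {map vtx (w′ ++ [ y ])}))))
  (linked-blocks bs (subst (Linked LetterStep) (sym letters) (p-step x ∷ walk⇒letterSteps w′ walk)))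
  (first-block letters)
  (last-block (p x ∷ map vtx (x ∷ w′ ++ [ y ])) letters)
  (subst SquareFree (sym letters) (letterWord-squareFree x y (x ∷ w′ ++ [ y ]) walk-squareFree))
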